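{- Let $q\ge 5$ be a prime power and let $\ell$ be a line of $\mathrm{PG}(3,q)$ containing no point of the twisted cubic $\mathcal{C}$. For each plane type $\pi\in\{\Gamma,2_{\mathcal C},3_{\mathcal C},\overline{1_{\mathcal C}},0_{\mathcal C}\}$ let $\Pi_\pi(\ell)$ denote the number of $\pi$-planes containing $\ell$. Then $$\Pi_{\Gamma}(\ell)+\Pi_{\overline{1_{\mathcal C}}}(\ell)+2\Pi_{2_{\mathcal C}}(\ell)+3\Pi_{3_{\mathcal C}}(\ell)=q+1,\qquad \Pi_{0_{\mathcal C}}(\ell)=\Pi_{2_{\mathcal C}}(\ell)+2\Pi_{3_{\mathcal C}}(\ell).$$
   Context: Let $q$ be a prime power and $\mathrm{PG}(3,q)$ the projective space over $\mathbb{F}_q$ with points $\mathbf{P}(x_0,x_1,x_2,x_3)$. Put $P(t)=\mathbf{P}(t^3,t^2,t,1)$ for $t\in\mathbb{F}_q$ and $P(\infty)=\mathbf{P}(1,0,0,0)$; the twisted cubic is $\mathcal{C}=\{P(t):t\in\mathbb{F}_q\cup\{\infty\}\}$. Denote by $\boldsymbol{\pi}(c_0,c_1,c_2,c_3)$ the plane $c_0x_0+c_1x_1+c_2x_2+c_3x_3=0$. The osculating plane at $P(t)$ is $\boldsymbol{\pi}(1,-3t,3t^2,-t^3)$ for $t\in\mathbb{F}_q$ and $\boldsymbol{\pi}(0,0,0,1)$ for $t=\infty$; these $q+1$ planes are the $\Gamma$-planes. Plane types: $\Gamma$-planes; for $d\in\{0,2,3\}$ a $d_{\mathcal C}$-plane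 is a plane containing exactly $d$ points of $\mathcal C$; a $\overline{1_{\mathcal C}}$-plane is a plane which is not a $\Gamma$-plane and contains exactly one point of $\mathcal C$. -}

module Defs where

open import Data.Nat using (ℕ; zero; suc; _+_)
open import Data.Bool using (Bool; true; false; _∧_; _∨_; not; if_then_else_)
open import Data.List using (List; []; _∷_; length; concatMap; map)
open import Data.Bool.ListAction using (any)
open import Data.List.Membership.Propositional using (_∈_)
open import Data.List.Relation.Unary.Unique.Propositional using (Unique)
open import Data.Product using (Σ; _×_; _,_)
open import Relation.Nullary using (¬_; does)
open import Relation.Binary.PropositionalEquality using (_≡_; _≢_)
open import Relation.Binary.Definitions using (DecidableEquality)
open import Algebra.Structures using (IsCommutativeRing)

count : {A : Set} → (A → Bool) → List A → ℕ
count p [] = 0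
count p (x ∷ xs) = if p x then suc (count p xs) else count p xs

record FiniteField : Set₁ where
  infixl 6 _+F_
  infixl 7 _*F_
  field
    F : Set
    _+F_ _*F_ : F → F → F
    -F_ : F → F
    0F 1F : F
    isCommRing : IsCommutativeRing _≡_ _+F_ _*F_ -F_ 0F 1F
    _≟F_ : DecidableEquality F
    0≢1 : 0F ≢ 1F
    inverse : ∀ x → x ≢ 0F → Σ F (λ y → x *F y ≡ 1F)
    elements : List F
    complete : ∀ x → x ∈ elements
    unique : Unique elements

  q : ℕ
  q = length elements

  _==_ : F → F → Bool
  x == y = does (x ≟F y)

  -- homogeneous coordinates (x0,x1,x2,x3) of PG(3,q) / plane coefficients
  V4 : Set
  V4 = F × F × F × F

  zeroV : V4
  zeroV = 0F , 0F , 0F , 0F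

  _·_ : F → V4 → V4
  a · (x0 , x1 , x2 , x3) = a *F x0 , a *F x1 , a *F x2 , a *F x3

  _⊕_ : V4 → V4 → V4
  (x0 , x1 , x2 , x3) ⊕ (y0 , y1 , y2 , y3) = x0 +F y0 , x1 +F y1 , x2 +F y2 , x3 +F y3

  _==V_ : V4 → V4 → Bool
  (x0 , x1 , x2 , x3) ==V (y0 , y1 , y2 , y3) = (x0 == y0) ∧ (x1 == y1) ∧ (x2 == y2) ∧ (x3 == y3)

  dot : V4 → V4 → F
  dot (c0 , c1 , c2 , c3) (x0 , x1 , x2 , x3) = c0 *F x0 +F c1 *F x1 +F c2 *F x2 +F c3 *F x3

  allV4 : List V4
  allV4 = concatMap (λ a → concatMap (λ b → concatMap (λ c → map (λ d → (a , b , c , d)) elements) elements) elements) elements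

  -- canonical representative of a projective point / plane:
  -- first nonzero coordinate equals 1
  normalized : V4 → Bool
  normalized (x0 , x1 , x2 , x3) =
    if not (x0 == 0F) then x0 == 1F
    else if not (x1 == 0F) then x1 == 1F
    else if not (x2 == 0F) then x2 == 1F
    else x3 == 1F

  planes : List V4
  planes = Data.List.filterᵇ normalized allV4
    where import Data.List

  three : F
  three = 1F +F 1F +F 1F

  Pt : F → V4
  Pt t = t *F t *F t , t *F t , t , 1F

  Pinf : V4
  Pinf = 1F , 0F , 0F , 0F

  osc : F → V4
  osc t = 1F , -F (three *F t) , three *F (t *F t) , -F (t *F t *F t)

  oscInf : V4
  oscInf = 0F , 0F , 0F , 1F

  proportional : V4 → V4 → Bool
  proportional c v = any (λ a → not (a == 0F) ∧ (c ==V (a · v))) elements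

  isΓ : V4 → Bool
  isΓ c = any (λ t → proportional c (osc t)) elements ∨ proportional c oscInf

  -- number of points of the twisted cubic on the plane π(c)
  -- (the q+1 points P(t), t ∈ F_q ∪ {∞}, are pairwise distinct)
  nC : V4 → ℕ
  nC c = count (λ t → dot c (Pt t) == 0F) elements + (if dot c Pinf == 0F then 1 else 0)

  _==ℕ_ : ℕ → ℕ → Bool
  m ==ℕ n = does (m Data.Nat.≟ n)
    where import Data.Nat

  isDPlane : ℕ → V4 → Bool
  isDPlane d c = nC c ==ℕ d

  isOneBar : V4 → Bool
  isOneBar c = not (isΓ c) ∧ (nC c ==ℕ 1)

  -- A line ℓ of PG(3,q) given as span of two linearly independent vectors u, v
  Independent : V4 → V4 → Set
  Independent u v = ∀ a b → (a · u) ⊕ (b · v) ≡ zeroV → (a ≡ 0F) × (b ≡ 0F)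

  OnLine : V4 → V4 → V4 → Set
  OnLine u v x = Σ F (λ a → Σ F (λ b → x ≡ (a · u) ⊕ (b · v)))

  NoCubicPoint : V4 → V4 → Set
  NoCubicPoint u v = (∀ t → ¬ OnLine u v (Pt t)) × ¬ OnLine u v Pinf

  containsLine : V4 → V4 → V4 → Bool
  containsLine u v c = (dot c u == 0F) ∧ (dot c v == 0F)

  Π : (V4 → Bool) → V4 → V4 → ℕ
  Π type u v = count (λ c → containsLine u v c ∧ type c) planes

{-# OPTIONS --safe #-}

-- A plane through ℓ is a nonzero solution, up to a unit factor, of c·u = c·v = 0. These
-- solutions form a 2-dimensional space (q² vectors), and a 1-dimensional one (q vectors) once
-- c·p = 0 is imposed for a point p ∉ ℓ; since every nonzero vector is a unique unit multiple of
-- a normalized one, q + 1 planes contain ℓ and exactly one contains ℓ and p. As ℓ misses 𝒞,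
-- counting incident pairs (plane ⊇ ℓ, point of 𝒞) gives ∑ nC = q + 1 over the planes through ℓ.
-- A plane meets 𝒞 in the roots of a nonzero cubic (and possibly P(∞)), so nC ≤ 3, and a
-- Γ-plane meets 𝒞 in its point of osculation only. Hence Π₀ + Π₁ + Π₂ + Π₃ = q + 1 =
-- Π₁ + 2Π₂ + 3Π₃ with Π₁ = Π_Γ + Π_1̄, which gives both identities.
module Submission where

open import Defs
open import Algebra.Bundles using (CommutativeRing)
open import Data.Bool using (Bool; true; false; _∧_; _∨_; not; if_then_else_; T)
open import Data.Bool.Properties using (∧-identityʳ; T-∧; T-∨)
open import Data.Empty using (⊥; ⊥-elim)
open import Data.Integer as ℤ using (ℤ; -[1+_]; _⊖_; sign; ∣_∣; _◃_)
import Data.Integer.Properties as ℤ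
open import Data.List using (List; []; _∷_; _++_; map; concatMap; filterᵇ; length)
open import Data.List.Membership.Propositional using (_∈_)
open import Data.List.Relation.Unary.All using (All; []; _∷_)
open import Data.List.Relation.Unary.AllPairs using ([]; _∷_)
open import Data.List.Relation.Unary.Any using (here; there; satisfied)
open import Data.List.Relation.Unary.Any.Properties using (any⁻)
open import Data.List.Relation.Unary.Unique.Propositional using (Unique)
open import Data.Maybe using (Maybe; just; nothing)
open import Data.Nat as ℕ using (ℕ; zero; suc; _≤_; z≤n; s≤s)
import Data.Nat.Properties as ℕ
open import Algebra.Properties.CommutativeSemigroup ℕ.+-commutativeSemigroup using () renaming (interchange to +-interchange)
open import Data.Nat.Tactic.RingSolver using (solve-∀)
open import Data.Product using (Σ; ∃; _×_; _,_; proj₁; proj₂)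
open import Data.Product.Function.NonDependent.Propositional using (_×-⇔_)
open import Data.Sign as Sign using (Sign)
open import Data.Sum using (_⊎_; inj₁; inj₂)
open import Function.Bundles using (_⇔_; mk⇔; Equivalence)
import Function.Properties.Equivalence as ⇔
open import Level using (0ℓ)
open import Relation.Binary.Definitions using (DecidableEquality)
open import Relation.Binary.PropositionalEquality using (_≡_; _≢_; refl; sym; trans; cong; cong₂; subst; ≢-sym; module ≡-Reasoning)
open import Relation.Nullary using (¬_; does; yes; no)
open import Relation.Nullary.Decidable using (dec-true; dec-false; does-⇔; _×-dec_)

module IntegerCoefficients {c ℓ} (R : CommutativeRing c ℓ) where
  open CommutativeRing R renaming (refl to ≈-refl; sym to ≈-sym; trans to ≈-trans)
  open import Algebra.Properties.Ring ring using (-‿involutive; -‿distribˡ-*; -‿distribʳ-*; -0#≈0#)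
  open import Algebra.Properties.AbelianGroup +-abelianGroup using (⁻¹-∙-comm)
  open import Algebra.Properties.CommutativeSemigroup +-commutativeSemigroup using (interchange)
  open import Algebra.Properties.Semiring.Mult.TCOptimised semiring using (1+×; ×-homo-+; ×1-homo-*) renaming (_×_ to _×ᵣ_)
  open import Algebra.Solver.Ring.AlmostCommutativeRing using (_-Raw-AlmostCommutative⟶_; fromCommutativeRing)
  open import Relation.Binary.Reasoning.Setoid setoid

  fromℕ : ℕ → Carrier
  fromℕ n = n ×ᵣ 1#

  signed : Sign → Carrier → Carrier
  signed Sign.+ x = x
  signed Sign.- x = - x

  fromℤ : ℤ → Carrier
  fromℤ i = signed (sign i) (fromℕ ∣ i ∣)

  fromℤ-◃ : ∀ s n → fromℤ (s ◃ n) ≈ signed s (fromℕ n)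
  fromℤ-◃ Sign.+ zero    = ≈-refl
  fromℤ-◃ Sign.- zero    = ≈-sym -0#≈0#
  fromℤ-◃ Sign.+ (suc n) = ≈-refl
  fromℤ-◃ Sign.- (suc n) = ≈-refl

  signed-* : ∀ s t x y → signed (s Sign.* t) (x * y) ≈ signed s x * signed t y
  signed-* Sign.+ Sign.+ x y = ≈-refl
  signed-* Sign.+ Sign.- x y = -‿distribʳ-* x y
  signed-* Sign.- Sign.+ x y = -‿distribˡ-* x y
  signed-* Sign.- Sign.- x y = begin
    x * y         ≈⟨ -‿involutive (x * y) ⟨
    - - (x * y)   ≈⟨ -‿cong (-‿distribˡ-* x y) ⟩
    - (- x * y)   ≈⟨ -‿distribʳ-* (- x) y ⟩
    - x * - y     ∎

  fromℤ-* : ∀ i j → fromℤ (i ℤ.* j) ≈ fromℤ i * fromℤ j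
  fromℤ-* i j = begin
    fromℤ (sign i Sign.* sign j ◃ ∣ i ∣ ℕ.* ∣ j ∣)             ≈⟨ fromℤ-◃ (sign i Sign.* sign j) (∣ i ∣ ℕ.* ∣ j ∣) ⟩
    signed (sign i Sign.* sign j) (fromℕ (∣ i ∣ ℕ.* ∣ j ∣))     ≈⟨ signed-cong (sign i Sign.* sign j) (×1-homo-* ∣ i ∣ ∣ j ∣) ⟩
    signed (sign i Sign.* sign j) (fromℕ ∣ i ∣ * fromℕ ∣ j ∣)   ≈⟨ signed-* (sign i) (sign j) _ _ ⟩
    fromℤ i * fromℤ j                                          ∎
    where
    signed-cong : ∀ s {x y} → x ≈ y → signed s x ≈ signed s y
    signed-cong Sign.+ x≈y = x≈y
    signed-cong Sign.- x≈y = -‿cong x≈y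

  fromℤ-⊖ : ∀ m n → fromℤ (m ⊖ n) ≈ fromℕ m - fromℕ n
  fromℤ-⊖ zero    zero    = ≈-sym (≈-trans (+-identityˡ (- 0#)) -0#≈0#)
  fromℤ-⊖ zero    (suc n) = ≈-sym (+-identityˡ _)
  fromℤ-⊖ (suc m) zero    = ≈-sym (≈-trans (+-congˡ -0#≈0#) (+-identityʳ _))
  fromℤ-⊖ (suc m) (suc n) = begin
    fromℤ (suc m ⊖ suc n)                  ≡⟨ cong fromℤ (ℤ.[1+m]⊖[1+n]≡m⊖n m n) ⟩
    fromℤ (m ⊖ n)                          ≈⟨ fromℤ-⊖ m n ⟩
    fromℕ m - fromℕ n                      ≈⟨ +-identityˡ _ ⟨
    0# + (fromℕ m - fromℕ n)               ≈⟨ +-congʳ (-‿inverseʳ 1#) ⟨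
    (1# - 1#) + (fromℕ m - fromℕ n)        ≈⟨ interchange 1# (- 1#) (fromℕ m) (- fromℕ n) ⟩
    (1# + fromℕ m) + (- 1# - fromℕ n)      ≈⟨ +-congˡ (⁻¹-∙-comm 1# (fromℕ n)) ⟩
    (1# + fromℕ m) - (1# + fromℕ n)        ≈⟨ +-cong (1+× m 1#) (-‿cong (1+× n 1#)) ⟨
    fromℕ (suc m) - fromℕ (suc n)          ∎

  fromℤ-+ : ∀ i j → fromℤ (i ℤ.+ j) ≈ fromℤ i + fromℤ j
  fromℤ-+ (ℤ.+ m)    (ℤ.+ n)      = ×-homo-+ 1# m n
  fromℤ-+ (ℤ.+ m)    -[1+ n ]   = fromℤ-⊖ m (suc n)
  fromℤ-+ -[1+ m ]   (ℤ.+ n)    = ≈-trans (fromℤ-⊖ n (suc m)) (+-comm _ _)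
  fromℤ-+ -[1+ m ]   -[1+ n ]   = begin
    - fromℕ (suc (suc (m ℕ.+ n)))          ≡⟨ cong (λ k → - fromℕ (suc k)) (ℕ.+-suc m n) ⟨
    - fromℕ (suc m ℕ.+ suc n)              ≈⟨ -‿cong (×-homo-+ 1# (suc m) (suc n)) ⟩
    - (fromℕ (suc m) + fromℕ (suc n))      ≈⟨ ⁻¹-∙-comm _ _ ⟨
    - fromℕ (suc m) - fromℕ (suc n)        ∎

  fromℤ-neg : ∀ i → fromℤ (ℤ.- i) ≈ - fromℤ i
  fromℤ-neg (ℤ.+ zero) = ≈-sym -0#≈0#
  fromℤ-neg (ℤ.+ suc n) = ≈-refl
  fromℤ-neg -[1+ n ]   = ≈-sym (-‿involutive _)

  fromℤ-homomorphism : ℤ.+-*-rawRing -Raw-AlmostCommutative⟶ fromCommutativeRing R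
  fromℤ-homomorphism = record
    { ⟦_⟧ = fromℤ ; +-homo = fromℤ-+ ; *-homo = fromℤ-* ; -‿homo = fromℤ-neg
    ; 0-homo = ≈-refl ; 1-homo = ≈-refl }

  fromℤ-≟ : ∀ i j → Maybe (fromℤ i ≈ fromℤ j)
  fromℤ-≟ i j with i ℤ.≟ j
  ... | yes refl = just ≈-refl
  ... | no _     = nothing

  open import Algebra.Solver.Ring ℤ.+-*-rawRing (fromCommutativeRing R) fromℤ-homomorphism fromℤ-≟ public

open import Data.Nat using (_+_; _*_)

𝟙 : Bool → ℕ
𝟙 b = if b then 1 else 0

𝟙-∧ : ∀ a b → 𝟙 (a ∧ b) ≡ 𝟙 a * 𝟙 b
𝟙-∧ false b = refl
𝟙-∧ true  b = sym (ℕ.+-identityʳ (𝟙 b))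

𝟙-∧³ : ∀ a b c → 𝟙 ((a ∧ b) ∧ c) ≡ 𝟙 a * (𝟙 b * 𝟙 c)
𝟙-∧³ a b c = trans (𝟙-∧ (a ∧ b) c) (trans (cong (_* 𝟙 c) (𝟙-∧ a b)) (ℕ.*-assoc (𝟙 a) (𝟙 b) (𝟙 c)))

𝟙-not : ∀ b → 𝟙 b + 𝟙 (not b) ≡ 1
𝟙-not false = refl
𝟙-not true  = refl

𝟙-T : ∀ {b} → T b → 𝟙 b ≡ 1
𝟙-T {true} _ = refl

𝟙≤1 : ∀ b → 𝟙 b ≤ 1
𝟙≤1 false = z≤n
𝟙≤1 true  = s≤s z≤n

module _ {A : Set} where

  ∑ : List A → (A → ℕ) → ℕ
  ∑ []       f = 0
  ∑ (x ∷ xs) f = f x + ∑ xs f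

  syntax ∑ xs (λ x → e) = ∑[ x ∈ xs ] e

  ∑-cong : ∀ xs {f g : A → ℕ} → (∀ x → f x ≡ g x) → ∑ xs f ≡ ∑ xs g
  ∑-cong []       f≗g = refl
  ∑-cong (x ∷ xs) f≗g = cong₂ _+_ (f≗g x) (∑-cong xs f≗g)

  ∑-+ : ∀ xs (f g : A → ℕ) → ∑[ x ∈ xs ] (f x + g x) ≡ ∑ xs f + ∑ xs g
  ∑-+ []       f g = refl
  ∑-+ (x ∷ xs) f g = begin
    f x + g x + ∑[ y ∈ xs ] (f y + g y)  ≡⟨ cong ((f x + g x) +_) (∑-+ xs f g) ⟩
    f x + g x + (∑ xs f + ∑ xs g)        ≡⟨ +-interchange (f x) (g x) (∑ xs f) (∑ xs g) ⟩
    f x + ∑ xs f + (g x + ∑ xs g)        ∎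
    where open ≡-Reasoning

  ∑-+³ : ∀ xs (f g h : A → ℕ) → ∑[ x ∈ xs ] (f x + g x + h x) ≡ ∑ xs f + ∑ xs g + ∑ xs h
  ∑-+³ xs f g h = trans (∑-+ xs (λ x → f x + g x) h) (cong (_+ ∑ xs h) (∑-+ xs f g))

  ∑-+⁴ : ∀ xs (f g h k : A → ℕ) → ∑[ x ∈ xs ] (f x + g x + h x + k x) ≡ ∑ xs f + ∑ xs g + ∑ xs h + ∑ xs k
  ∑-+⁴ xs f g h k = trans (∑-+ xs (λ x → f x + g x + h x) k) (cong (_+ ∑ xs k) (∑-+³ xs f g h))

  ∑-*ˡ : ∀ xs k (f : A → ℕ) → ∑[ x ∈ xs ] (k * f x) ≡ k * ∑ xs f
  ∑-*ˡ []       k f = sym (ℕ.*-zeroʳ k)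
  ∑-*ˡ (x ∷ xs) k f = trans (cong ((k * f x) +_) (∑-*ˡ xs k f)) (sym (ℕ.*-distribˡ-+ k (f x) (∑ xs f)))

  ∑-*ʳ : ∀ xs k (f : A → ℕ) → ∑[ x ∈ xs ] (f x * k) ≡ ∑ xs f * k
  ∑-*ʳ xs k f = trans (∑-cong xs (λ x → ℕ.*-comm (f x) k)) (trans (∑-*ˡ xs k f) (ℕ.*-comm k (∑ xs f)))

  ∑-const : ∀ xs k → ∑[ _ ∈ xs ] k ≡ length xs * k
  ∑-const []       k = refl
  ∑-const (x ∷ xs) k = cong (k +_) (∑-const xs k)

  ∑-++ : ∀ xs ys (f : A → ℕ) → ∑ (xs ++ ys) f ≡ ∑ xs f + ∑ ys f
  ∑-++ []       ys f = refl
  ∑-++ (x ∷ xs) ys f = trans (cong (f x +_) (∑-++ xs ys f)) (sym (ℕ.+-assoc (f x) (∑ xs f) (∑ ys f)))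

  ∑-filterᵇ : ∀ (p : A → Bool) xs (f : A → ℕ) → ∑ (filterᵇ p xs) f ≡ ∑[ x ∈ xs ] (𝟙 (p x) * f x)
  ∑-filterᵇ p []       f = refl
  ∑-filterᵇ p (x ∷ xs) f with p x
  ... | true  = cong₂ _+_ (sym (ℕ.+-identityʳ (f x))) (∑-filterᵇ p xs f)
  ... | false = ∑-filterᵇ p xs f

  ∑-filterᵇ-cong : ∀ (p : A → Bool) xs {f g : A → ℕ} → (∀ x → T (p x) → f x ≡ g x) →
                   ∑ (filterᵇ p xs) f ≡ ∑ (filterᵇ p xs) g
  ∑-filterᵇ-cong p []       f≗g = refl
  ∑-filterᵇ-cong p (x ∷ xs) f≗g with p x in px
  ... | true  = cong₂ _+_ (f≗g x (subst T (sym px) _)) (∑-filterᵇ-cong p xs f≗g)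
  ... | false = ∑-filterᵇ-cong p xs f≗g

  count≡∑ : ∀ (p : A → Bool) xs → count p xs ≡ ∑[ x ∈ xs ] 𝟙 (p x)
  count≡∑ p []       = refl
  count≡∑ p (x ∷ xs) with p x
  ... | true  = cong suc (count≡∑ p xs)
  ... | false = count≡∑ p xs

  count-cong : ∀ {p p′ : A → Bool} xs → (∀ x → p x ≡ p′ x) → count p xs ≡ count p′ xs
  count-cong {p} {p′} xs p≗p′ = trans (count≡∑ p xs) (trans (∑-cong xs (λ x → cong 𝟙 (p≗p′ x))) (sym (count≡∑ p′ xs)))

  count-none : ∀ {p : A → Bool} xs → (∀ x → p x ≡ false) → count p xs ≡ 0
  count-none []                  none = refl
  count-none {p} (x ∷ xs) none rewrite none x = count-none xs none

  count-mono : ∀ {p p′ : A → Bool} xs → (∀ x → T (p x) → T (p′ x)) → count p xs ≤ count p′ xs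
  count-mono []                   p⊆p′ = z≤n
  count-mono {p} {p′} (x ∷ xs) p⊆p′ with p x in px | p′ x in p′x
  ... | true  | true  = s≤s (count-mono xs p⊆p′)
  ... | true  | false = ⊥-elim (subst T p′x (p⊆p′ x (subst T (sym px) _)))
  ... | false | true  = ℕ.m≤n⇒m≤1+n (count-mono xs p⊆p′)
  ... | false | false = count-mono xs p⊆p′

  count-∨ : ∀ (p p′ : A → Bool) xs → count (λ x → p x ∨ p′ x) xs ≤ count p xs + count p′ xs
  count-∨ p p′ []       = z≤n
  count-∨ p p′ (x ∷ xs) with p x | p′ x
  ... | true  | true  = s≤s (ℕ.≤-trans (count-∨ p p′ xs) (ℕ.+-monoʳ-≤ (count p xs) (ℕ.n≤1+n (count p′ xs))))
  ... | true  | false = s≤s (count-∨ p p′ xs)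
  ... | false | true  = ℕ.≤-trans (s≤s (count-∨ p p′ xs)) (ℕ.≤-reflexive (sym (ℕ.+-suc (count p xs) (count p′ xs))))
  ... | false | false = count-∨ p p′ xs

  count≡0⊎∃ : ∀ (p : A → Bool) xs → count p xs ≡ 0 ⊎ ∃ λ x → T (p x)
  count≡0⊎∃ p []       = inj₁ refl
  count≡0⊎∃ p (x ∷ xs) with p x in px
  ... | true  = inj₂ (x , subst T (sym px) _)
  ... | false = count≡0⊎∃ p xs

  ∑-≥-term : ∀ {xs x} (f : A → ℕ) → x ∈ xs → f x ≤ ∑ xs f
  ∑-≥-term {y ∷ ys} f (here refl) = ℕ.m≤m+n (f y) (∑ ys f)
  ∑-≥-term {y ∷ ys} f (there x∈) = ℕ.≤-trans (∑-≥-term f x∈) (ℕ.m≤n+m (∑ ys f) (f y))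

  module _ (_≟_ : DecidableEquality A) where

    ∑-δ-∉ : ∀ {xs y} → All (y ≢_) xs → (f : A → ℕ) → ∑[ x ∈ xs ] (𝟙 (does (x ≟ y)) * f x) ≡ 0
    ∑-δ-∉ []                          f = refl
    ∑-δ-∉ {x ∷ xs} {y} (y≢x ∷ y∉xs) f rewrite dec-false (x ≟ y) (≢-sym y≢x) = ∑-δ-∉ y∉xs f

    ∑-δ : ∀ {xs} → Unique xs → ∀ {y} → y ∈ xs → (f : A → ℕ) → ∑[ x ∈ xs ] (𝟙 (does (x ≟ y)) * f x) ≡ f y
    ∑-δ {x ∷ xs} (x∉xs ∷ uniq) {y} y∈ f with x ≟ y | y∈
    ... | yes refl | _          = trans (cong₂ _+_ (ℕ.+-identityʳ (f x)) (∑-δ-∉ x∉xs f)) (ℕ.+-identityʳ (f x))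
    ... | no x≢y   | here y≡x   = ⊥-elim (x≢y (sym y≡x))
    ... | no x≢y   | there y∈xs = ∑-δ uniq y∈xs f

module _ {A B : Set} where

  ∑-comm : ∀ (xs : List A) (ys : List B) (f : A → B → ℕ) →
           ∑[ x ∈ xs ] ∑[ y ∈ ys ] f x y ≡ ∑[ y ∈ ys ] ∑[ x ∈ xs ] f x y
  ∑-comm []       ys f = sym (trans (∑-const ys 0) (ℕ.*-zeroʳ (length ys)))
  ∑-comm (x ∷ xs) ys f = trans (cong (∑ ys (f x) +_) (∑-comm xs ys f)) (sym (∑-+ ys (f x) (λ y → ∑[ x ∈ xs ] f x y)))

  ∑-map : ∀ (g : A → B) xs (f : B → ℕ) → ∑ (map g xs) f ≡ ∑[ x ∈ xs ] f (g x)
  ∑-map g []       f = refl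
  ∑-map g (x ∷ xs) f = cong (f (g x) +_) (∑-map g xs f)

  ∑-concatMap : ∀ (g : A → List B) xs (f : B → ℕ) → ∑ (concatMap g xs) f ≡ ∑[ x ∈ xs ] ∑ (g x) f
  ∑-concatMap g []       f = refl
  ∑-concatMap g (x ∷ xs) f = trans (∑-++ (g x) (concatMap g xs) f) (cong (∑ (g x) f +_) (∑-concatMap g xs f))

count-difference : ∀ {n₀ n₁ n₂ n₃ m} → n₀ + n₁ + n₂ + n₃ ≡ m → n₁ + 2 * n₂ + 3 * n₃ ≡ m → n₀ ≡ n₂ + 2 * n₃
count-difference {n₀} {n₁} {n₂} {n₃} partition weighted = ℕ.+-cancelʳ-≡ (n₁ + n₂ + n₃) n₀ (n₂ + 2 * n₃) (begin
  n₀ + (n₁ + n₂ + n₃)             ≡⟨ regroup n₀ n₁ n₂ n₃ ⟩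
  n₀ + n₁ + n₂ + n₃               ≡⟨ trans partition (sym weighted) ⟩
  n₁ + 2 * n₂ + 3 * n₃            ≡⟨ spread n₁ n₂ n₃ ⟩
  n₂ + 2 * n₃ + (n₁ + n₂ + n₃)    ∎)
  where
  open ≡-Reasoning
  regroup : ∀ a b c d → a + (b + c + d) ≡ a + b + c + d
  regroup = solve-∀
  spread : ∀ b c d → b + 2 * c + 3 * d ≡ c + 2 * d + (b + c + d)
  spread = solve-∀

module _ (K : FiniteField) where
  open FiniteField K

  commRing : CommutativeRing 0ℓ 0ℓ
  commRing = record { isCommutativeRing = isCommRing }

  open CommutativeRing commRing using (+-assoc; +-identityˡ; +-identityʳ; *-identityˡ; *-identityʳ; *-assoc; *-comm; zeroʳ)
  open IntegerCoefficients commRing using (solve; _:=_; _:+_; _:-_; _:*_; :-_; con)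

  infixl 6 _-F_
  _-F_ : F → F → F
  x -F y = x +F -F y

  inv : ∀ x → x ≢ 0F → F
  inv x x≢0 = proj₁ (inverse x x≢0)

  *-inverseʳ : ∀ x (x≢0 : x ≢ 0F) → x *F inv x x≢0 ≡ 1F
  *-inverseʳ x x≢0 = proj₂ (inverse x x≢0)

  *-inverseˡ : ∀ x (x≢0 : x ≢ 0F) → inv x x≢0 *F x ≡ 1F
  *-inverseˡ x x≢0 = trans (*-comm _ x) (*-inverseʳ x x≢0)

  *-cancelˡ : ∀ {x y z} (x≢0 : x ≢ 0F) → x *F y ≡ z → y ≡ inv x x≢0 *F z
  *-cancelˡ {x} {y} x≢0 refl = begin
    y                          ≡⟨ *-identityˡ y ⟨
    1F *F y                    ≡⟨ cong (_*F y) (*-inverseˡ x x≢0) ⟨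
    inv x x≢0 *F x *F y        ≡⟨ *-assoc _ x y ⟩
    inv x x≢0 *F (x *F y)      ∎
    where open ≡-Reasoning

  *-inverse-cancel : ∀ {x} (x≢0 : x ≢ 0F) y → x *F (inv x x≢0 *F y) ≡ y
  *-inverse-cancel {x} x≢0 y = trans (sym (*-assoc x _ y)) (trans (cong (_*F y) (*-inverseʳ x x≢0)) (*-identityˡ y))

  x*y≡0⇒y≡0 : ∀ {x y} → x ≢ 0F → x *F y ≡ 0F → y ≡ 0F
  x*y≡0⇒y≡0 x≢0 xy≡0 = trans (*-cancelˡ x≢0 xy≡0) (zeroʳ _)

  x*y≡0⇒x≡0⊎y≡0 : ∀ x {y} → x *F y ≡ 0F → x ≡ 0F ⊎ y ≡ 0F
  x*y≡0⇒x≡0⊎y≡0 x xy≡0 with x ≟F 0F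
  ... | yes x≡0 = inj₁ x≡0
  ... | no  x≢0 = inj₂ (x*y≡0⇒y≡0 x≢0 xy≡0)

  x-y≡0⇒x≡y : ∀ {x y} → x -F y ≡ 0F → x ≡ y
  x-y≡0⇒x≡y {x} {y} x-y≡0 = begin
    x                ≡⟨ solve 2 (λ x y → x := (x :- y) :+ y) refl x y ⟩
    (x -F y) +F y    ≡⟨ cong (_+F y) x-y≡0 ⟩
    0F +F y          ≡⟨ +-identityˡ y ⟩
    y                ∎
    where open ≡-Reasoning

  ==⇒≡ : ∀ {x y} → T (x == y) → x ≡ y
  ==⇒≡ {x} {y} x==y with x ≟F y
  ... | yes x≡y = x≡y

  ≡⇒== : ∀ {x y} → x ≡ y → T (x == y)
  ≡⇒== {x} {y} x≡y with x ≟F y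
  ... | yes _   = _
  ... | no  x≢y = x≢y x≡y

  ==-≡ : ∀ {x y x′ y′} → (x ≡ y → x′ ≡ y′) → (x′ ≡ y′ → x ≡ y) → (x == y) ≡ (x′ == y′)
  ==-≡ {x} {y} {x′} {y′} to from = does-⇔ (mk⇔ to from) (x ≟F y) (x′ ≟F y′)

  ∑-δF : ∀ y (f : F → ℕ) → ∑[ x ∈ elements ] (𝟙 (x == y) * f x) ≡ f y
  ∑-δF y f = ∑-δ _≟F_ unique (complete y) f

  count-== : ∀ y → ∑[ x ∈ elements ] 𝟙 (x == y) ≡ 1
  count-== y = trans (∑-cong elements (λ x → sym (ℕ.*-identityʳ (𝟙 (x == y))))) (∑-δF y (λ _ → 1))

  ∑-1 : ∑[ _ ∈ elements ] 1 ≡ q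
  ∑-1 = trans (∑-const elements 1) (ℕ.*-identityʳ q)

  ∑-scale : ∀ {a} → a ≢ 0F → (f : F → ℕ) → ∑[ x ∈ elements ] f (a *F x) ≡ ∑ elements f
  ∑-scale {a} a≢0 f = begin
    ∑[ x ∈ elements ] f (a *F x)                                   ≡⟨ ∑-cong elements (λ x → ∑-δF (a *F x) f) ⟨
    ∑[ x ∈ elements ] ∑[ y ∈ elements ] (𝟙 (y == (a *F x)) * f y)    ≡⟨ ∑-comm elements elements _ ⟩
    ∑[ y ∈ elements ] ∑[ x ∈ elements ] (𝟙 (y == (a *F x)) * f y)    ≡⟨ ∑-cong elements (λ y → ∑-*ʳ elements (f y) _) ⟩
    ∑[ y ∈ elements ] (∑[ x ∈ elements ] 𝟙 (y == (a *F x)) * f y)    ≡⟨ ∑-cong elements (λ y → cong (_* f y) (preimage y)) ⟩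
    ∑[ y ∈ elements ] (1 * f y)                                     ≡⟨ ∑-cong elements (λ y → ℕ.*-identityˡ (f y)) ⟩
    ∑ elements f                                                    ∎
    where
    open ≡-Reasoning
    preimage : ∀ y → ∑[ x ∈ elements ] 𝟙 (y == (a *F x)) ≡ 1
    preimage y = trans (∑-cong elements (λ x → cong 𝟙 (==-≡ (λ y≡ax → *-cancelˡ a≢0 (sym y≡ax))
                                                           (λ x≡a⁻¹y → sym (trans (cong (a *F_) x≡a⁻¹y) (*-inverse-cancel a≢0 y))))))
                       (count-== (inv a a≢0 *F y))

  #units : ℕ
  #units = ∑[ a ∈ elements ] 𝟙 (not (a == 0F))

  ∑-split-0 : ∀ (h : F → ℕ) → ∑ elements h ≡ h 0F + ∑[ a ∈ elements ] (𝟙 (not (a == 0F)) * h a)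
  ∑-split-0 h = begin
    ∑ elements h                                                                     ≡⟨ ∑-cong elements split ⟩
    ∑[ a ∈ elements ] (𝟙 (a == 0F) * h a + 𝟙 (not (a == 0F)) * h a)                  ≡⟨ ∑-+ elements _ _ ⟩
    ∑[ a ∈ elements ] (𝟙 (a == 0F) * h a) + ∑[ a ∈ elements ] (𝟙 (not (a == 0F)) * h a)
                                                                                     ≡⟨ cong (_+ ∑[ a ∈ elements ] (𝟙 (not (a == 0F)) * h a)) (∑-δF 0F h) ⟩
    h 0F + ∑[ a ∈ elements ] (𝟙 (not (a == 0F)) * h a)                               ∎
    where
    open ≡-Reasoning
    split : ∀ a → h a ≡ 𝟙 (a == 0F) * h a + 𝟙 (not (a == 0F)) * h a
    split a = sym (trans (sym (ℕ.*-distribʳ-+ (h a) (𝟙 (a == 0F)) _))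
                         (trans (cong (_* h a) (𝟙-not (a == 0F))) (ℕ.*-identityˡ (h a))))

  ∑-units-const : ∀ {h : F → ℕ} {k} → (∀ a → a ≢ 0F → h a ≡ k) →
                  ∑[ a ∈ elements ] (𝟙 (not (a == 0F)) * h a) ≡ #units * k
  ∑-units-const {h} {k} h≡k = trans (∑-cong elements on-units) (∑-*ʳ elements k _)
    where
    on-units : ∀ a → 𝟙 (not (a == 0F)) * h a ≡ 𝟙 (not (a == 0F)) * k
    on-units a with a ≟F 0F
    ... | yes _   = refl
    ... | no  a≢0 = cong (1 *_) (h≡k a a≢0)

  #units+1≡q : #units + 1 ≡ q
  #units+1≡q = begin
    #units + 1                                      ≡⟨ ℕ.+-comm #units 1 ⟩
    1 + #units                                      ≡⟨ cong (1 +_) units-as-sum ⟩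
    1 + ∑[ a ∈ elements ] (𝟙 (not (a == 0F)) * 1)   ≡⟨ ∑-split-0 (λ _ → 1) ⟨
    ∑[ _ ∈ elements ] 1                             ≡⟨ ∑-1 ⟩
    q                                               ∎
    where
    open ≡-Reasoning
    units-as-sum : #units ≡ ∑[ a ∈ elements ] (𝟙 (not (a == 0F)) * 1)
    units-as-sum = sym (trans (∑-units-const (λ _ _ → refl)) (ℕ.*-identityʳ #units))

  1≤#units : 1 ≤ #units
  1≤#units = subst (_≤ #units) (cong (λ b → 𝟙 (not b)) (dec-false (1F ≟F 0F) (≢-sym 0≢1)))
                   (∑-≥-term (λ a → 𝟙 (not (a == 0F))) (complete 1F))

  ∑-projective-step : ∀ (A B : F → ℕ) → (∀ a → a ≢ 0F → A a ≡ A 1F) → (∀ a → a ≢ 0F → B a ≡ 𝟙 (a == 1F) * A a) →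
                      #units * B 0F + 1 ≡ A 0F → #units * ∑ elements B + 1 ≡ ∑ elements A
  ∑-projective-step A B A-const B-normal base = begin
    #units * ∑ elements B + 1                                   ≡⟨ cong (λ s → #units * s + 1) ∑B ⟩
    #units * (B 0F + A 1F) + 1                                  ≡⟨ rearrange #units (B 0F) (A 1F) ⟩
    #units * B 0F + 1 + #units * A 1F                           ≡⟨ cong (_+ #units * A 1F) base ⟩
    A 0F + #units * A 1F                                        ≡⟨ cong (A 0F +_) (∑-units-const A-const) ⟨
    A 0F + ∑[ a ∈ elements ] (𝟙 (not (a == 0F)) * A a)          ≡⟨ ∑-split-0 A ⟨
    ∑ elements A                                                ∎
    where
    open ≡-Reasoning
    rearrange : ∀ u b a → u * (b + a) + 1 ≡ u * b + 1 + u * a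
    rearrange = solve-∀
    on-units : ∀ a → 𝟙 (not (a == 0F)) * B a ≡ 𝟙 (a == 1F) * A 1F
    on-units a with a ≟F 0F
    ... | yes refl = cong (λ b → 𝟙 b * A 1F) (sym (dec-false (0F ≟F 1F) 0≢1))
    ... | no  a≢0  = trans (ℕ.+-identityʳ (B a)) (trans (B-normal a a≢0) (cong (𝟙 (a == 1F) *_) (A-const a a≢0)))
    ∑B : ∑ elements B ≡ B 0F + A 1F
    ∑B = trans (∑-split-0 B) (cong (B 0F +_) (trans (∑-cong elements on-units) (∑-δF 1F (λ _ → A 1F))))

  -- F⁺ n is F^(n+1), laid out so that V4 is definitionally F⁺ 3 and normalized is normalized⁺ 3.
  F⁺ : ℕ → Set
  F⁺ zero    = F
  F⁺ (suc n) = F × F⁺ n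

  ∑⁺ : ∀ n → (F⁺ n → ℕ) → ℕ
  ∑⁺ zero    f = ∑ elements f
  ∑⁺ (suc n) f = ∑[ a ∈ elements ] ∑⁺ n (λ x → f (a , x))

  scale⁺ : ∀ n → F → F⁺ n → F⁺ n
  scale⁺ zero    a x        = a *F x
  scale⁺ (suc n) a (x , xs) = a *F x , scale⁺ n a xs

  0⁺ : ∀ n → F⁺ n
  0⁺ zero    = 0F
  0⁺ (suc n) = 0F , 0⁺ n

  normalized⁺ : ∀ n → F⁺ n → Bool
  normalized⁺ zero    x        = x == 1F
  normalized⁺ (suc n) (x , xs) = if not (x == 0F) then x == 1F else normalized⁺ n xs

  ∑⁺-cong : ∀ n {f g : F⁺ n → ℕ} → (∀ x → f x ≡ g x) → ∑⁺ n f ≡ ∑⁺ n g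
  ∑⁺-cong zero    f≗g = ∑-cong elements f≗g
  ∑⁺-cong (suc n) f≗g = ∑-cong elements (λ a → ∑⁺-cong n (λ x → f≗g (a , x)))

  ∑⁺-*ˡ : ∀ n k (f : F⁺ n → ℕ) → ∑⁺ n (λ x → k * f x) ≡ k * ∑⁺ n f
  ∑⁺-*ˡ zero    k f = ∑-*ˡ elements k f
  ∑⁺-*ˡ (suc n) k f = trans (∑-cong elements (λ a → ∑⁺-*ˡ n k (λ x → f (a , x)))) (∑-*ˡ elements k _)

  ∑⁺-scale : ∀ n {a} → a ≢ 0F → (f : F⁺ n → ℕ) → ∑⁺ n (λ x → f (scale⁺ n a x)) ≡ ∑⁺ n f
  ∑⁺-scale zero    a≢0 f = ∑-scale a≢0 f
  ∑⁺-scale (suc n) {a} a≢0 f =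
    trans (∑-cong elements (λ b → ∑⁺-scale n a≢0 (λ x → f (a *F b , x))))
          (∑-scale a≢0 (λ b → ∑⁺ n (λ x → f (b , x))))

  projective-count : ∀ n (s : F⁺ n → Bool) → (∀ a x → a ≢ 0F → s (scale⁺ n a x) ≡ s x) → T (s (0⁺ n)) →
                     #units * ∑⁺ n (λ x → 𝟙 (normalized⁺ n x ∧ s x)) + 1 ≡ ∑⁺ n (λ x → 𝟙 (s x))
  projective-count zero s s-scale s-0 =
    ∑-projective-step (λ a → 𝟙 (s a)) (λ a → 𝟙 ((a == 1F) ∧ s a))
      (λ a a≢0 → cong 𝟙 (trans (cong s (sym (*-identityʳ a))) (s-scale a 1F a≢0)))
      (λ a _ → 𝟙-∧ (a == 1F) (s a))
      base
    where
    open ≡-Reasoning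
    base : #units * 𝟙 ((0F == 1F) ∧ s 0F) + 1 ≡ 𝟙 (s 0F)
    base = begin
      #units * 𝟙 ((0F == 1F) ∧ s 0F) + 1   ≡⟨ cong (λ b → #units * 𝟙 (b ∧ s 0F) + 1) (dec-false (0F ≟F 1F) 0≢1) ⟩
      #units * 0 + 1                       ≡⟨ cong (_+ 1) (ℕ.*-zeroʳ #units) ⟩
      1                                    ≡⟨ 𝟙-T s-0 ⟨
      𝟙 (s 0F)                             ∎
  projective-count (suc n) s s-scale s-0 = ∑-projective-step A B A-const B-normal base
    where
    A B : F → ℕ
    A a = ∑⁺ n (λ x → 𝟙 (s (a , x)))
    B a = ∑⁺ n (λ x → 𝟙 (normalized⁺ (suc n) (a , x) ∧ s (a , x)))

    A-const : ∀ a → a ≢ 0F → A a ≡ A 1F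
    A-const a a≢0 = trans (sym (∑⁺-scale n a≢0 (λ x → 𝟙 (s (a , x)))))
                          (∑⁺-cong n (λ x → cong 𝟙 (trans (cong (λ b → s (b , scale⁺ n a x)) (sym (*-identityʳ a)))
                                                           (s-scale a (1F , x) a≢0))))

    normalized-unit : ∀ {a} x → a ≢ 0F → normalized⁺ (suc n) (a , x) ≡ (a == 1F)
    normalized-unit {a} x a≢0 rewrite dec-false (a ≟F 0F) a≢0 = refl

    B-normal : ∀ a → a ≢ 0F → B a ≡ 𝟙 (a == 1F) * A a
    B-normal a a≢0 = trans (∑⁺-cong n (λ x → trans (cong (λ b → 𝟙 (b ∧ s (a , x))) (normalized-unit x a≢0))
                                                   (𝟙-∧ (a == 1F) (s (a , x)))))
                           (∑⁺-*ˡ n (𝟙 (a == 1F)) (λ x → 𝟙 (s (a , x))))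

    normalized-0 : ∀ x → normalized⁺ (suc n) (0F , x) ≡ normalized⁺ n x
    normalized-0 x rewrite dec-true (0F ≟F 0F) refl = refl

    base : #units * B 0F + 1 ≡ A 0F
    base = trans (cong (λ t → #units * t + 1) (∑⁺-cong n (λ x → cong (λ b → 𝟙 (b ∧ s (0F , x))) (normalized-0 x))))
                 (projective-count n (λ x → s (0F , x))
                    (λ a x a≢0 → trans (cong (λ b → s (b , scale⁺ n a x)) (sym (zeroʳ a))) (s-scale a (0F , x) a≢0))
                    s-0)

  x+y≡0⇒x≡-y : ∀ {x y} → x +F y ≡ 0F → x ≡ -F y
  x+y≡0⇒x≡-y {x} {y} x+y≡0 = begin
    x                  ≡⟨ solve 2 (λ x y → x := (x :+ y) :- y) refl x y ⟩
    (x +F y) -F y      ≡⟨ cong (_-F y) x+y≡0 ⟩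
    0F -F y            ≡⟨ +-identityˡ (-F y) ⟩
    -F y               ∎
    where open ≡-Reasoning

  x≡-y⇒x+y≡0 : ∀ {x y} → x ≡ -F y → x +F y ≡ 0F
  x≡-y⇒x+y≡0 {y = y} refl = solve 1 (λ y → :- y :+ y := con (ℤ.+ 0)) refl y

  cramer : ∀ {a b c d e f x y} (Δ≢0 : a *F d -F b *F c ≢ 0F) → let Δ⁻¹ = inv _ Δ≢0 in
           (x *F a +F y *F b ≡ e × x *F c +F y *F d ≡ f) ⇔
           (x ≡ Δ⁻¹ *F (e *F d -F b *F f) × y ≡ Δ⁻¹ *F (a *F f -F e *F c))
  cramer {a} {b} {c} {d} {e} {f} {x} {y} Δ≢0 = mk⇔ solution check
    where
    Δ⁻¹ : F
    Δ⁻¹ = inv _ Δ≢0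
    solution : x *F a +F y *F b ≡ e × x *F c +F y *F d ≡ f →
               x ≡ Δ⁻¹ *F (e *F d -F b *F f) × y ≡ Δ⁻¹ *F (a *F f -F e *F c)
    solution (refl , refl) =
      *-cancelˡ Δ≢0 (solve 6 (λ a b c d x y → (a :* d :- b :* c) :* x := (x :* a :+ y :* b) :* d :- b :* (x :* c :+ y :* d))
                             refl a b c d x y) ,
      *-cancelˡ Δ≢0 (solve 6 (λ a b c d x y → (a :* d :- b :* c) :* y := a :* (x :* c :+ y :* d) :- (x :* a :+ y :* b) :* c)
                             refl a b c d x y)
    check : x ≡ Δ⁻¹ *F (e *F d -F b *F f) × y ≡ Δ⁻¹ *F (a *F f -F e *F c) →
            x *F a +F y *F b ≡ e × x *F c +F y *F d ≡ f
    check (refl , refl) =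
      trans (solve 7 (λ a b c d e f i → i :* (e :* d :- b :* f) :* a :+ i :* (a :* f :- e :* c) :* b := e :* (i :* (a :* d :- b :* c)))
                     refl a b c d e f Δ⁻¹)
            (trans (cong (e *F_) (*-inverseˡ _ Δ≢0)) (*-identityʳ e)) ,
      trans (solve 7 (λ a b c d e f i → i :* (e :* d :- b :* f) :* c :+ i :* (a :* f :- e :* c) :* d := f :* (i :* (a :* d :- b :* c)))
                     refl a b c d e f Δ⁻¹)
            (trans (cong (f *F_) (*-inverseˡ _ Δ≢0)) (*-identityʳ f))

  count-linear-root : ∀ {a} → a ≢ 0F → ∀ b → ∑[ x ∈ elements ] 𝟙 ((a *F x +F b) == 0F) ≡ 1
  count-linear-root {a} a≢0 b = trans (∑-cong elements (λ x → cong 𝟙 (root x))) (count-== (inv a a≢0 *F -F b))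
    where
    root : ∀ x → ((a *F x +F b) == 0F) ≡ (x == (inv a a≢0 *F -F b))
    root x = ==-≡ (λ ax+b≡0 → *-cancelˡ a≢0 (x+y≡0⇒x≡-y ax+b≡0))
                  (λ x≡root → x≡-y⇒x+y≡0 (trans (cong (a *F_) x≡root) (*-inverse-cancel a≢0 (-F b))))

  count-linear₂-roots : ∀ {α β} → ¬ (α ≡ 0F × β ≡ 0F) →
                        ∑[ x ∈ elements ] ∑[ y ∈ elements ] 𝟙 ((α *F x +F β *F y) == 0F) ≡ q
  count-linear₂-roots {α} {β} ¬α≡β≡0 with α ≟F 0F | β ≟F 0F
  ... | yes refl | yes refl = ⊥-elim (¬α≡β≡0 (refl , refl))
  ... | no α≢0   | _        = begin
    ∑[ x ∈ elements ] ∑[ y ∈ elements ] 𝟙 ((α *F x +F β *F y) == 0F)   ≡⟨ ∑-comm elements elements _ ⟩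
    ∑[ y ∈ elements ] ∑[ x ∈ elements ] 𝟙 ((α *F x +F β *F y) == 0F)   ≡⟨ ∑-cong elements (λ y → count-linear-root α≢0 (β *F y)) ⟩
    ∑[ _ ∈ elements ] 1                                                ≡⟨ ∑-1 ⟩
    q                                                                  ∎
    where open ≡-Reasoning
  ... | yes refl | no β≢0   = begin
    ∑[ x ∈ elements ] ∑[ y ∈ elements ] 𝟙 ((0F *F x +F β *F y) == 0F)
                                      ≡⟨ ∑-cong elements (λ x → ∑-cong elements (λ y → cong (λ z → 𝟙 (z == 0F)) (drop x y))) ⟩
    ∑[ x ∈ elements ] ∑[ y ∈ elements ] 𝟙 ((β *F y +F 0F) == 0F)        ≡⟨ ∑-cong elements (λ _ → count-linear-root β≢0 0F) ⟩
    ∑[ _ ∈ elements ] 1                                                 ≡⟨ ∑-1 ⟩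
    q                                                                   ∎
    where
    open ≡-Reasoning
    drop : ∀ x y → 0F *F x +F β *F y ≡ β *F y +F 0F
    drop x y = solve 3 (λ x y β → con (ℤ.+ 0) :* x :+ β :* y := β :* y :+ con (ℤ.+ 0)) refl x y β

  ==-∧-≡ : ∀ {x₁ y₁ x₂ y₂ x₃ y₃ x₄ y₄ : F} → (x₁ ≡ y₁ × x₂ ≡ y₂) ⇔ (x₃ ≡ y₃ × x₄ ≡ y₄) →
           (x₁ == y₁) ∧ (x₂ == y₂) ≡ (x₃ == y₃) ∧ (x₄ == y₄)
  ==-∧-≡ {x₁} {y₁} {x₂} {y₂} {x₃} {y₃} {x₄} {y₄} e =
    does-⇔ e ((x₁ ≟F y₁) ×-dec (x₂ ≟F y₂)) ((x₃ ≟F y₃) ×-dec (x₄ ≟F y₄))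

  dot≡0⇔ : ∀ {c₀ c₁ c₂ c₃ w₀ w₁ w₂ w₃} →
           dot (c₀ , c₁ , c₂ , c₃) (w₀ , w₁ , w₂ , w₃) ≡ 0F ⇔ c₀ *F w₀ +F c₁ *F w₁ ≡ -F (c₂ *F w₂ +F c₃ *F w₃)
  dot≡0⇔ {c₀} {c₁} {c₂} {c₃} {w₀} {w₁} {w₂} {w₃} =
    mk⇔ (λ dot≡0 → x+y≡0⇒x≡-y (trans (sym split) dot≡0)) (λ eq → trans split (x≡-y⇒x+y≡0 eq))
    where
    split : dot (c₀ , c₁ , c₂ , c₃) (w₀ , w₁ , w₂ , w₃) ≡ c₀ *F w₀ +F c₁ *F w₁ +F (c₂ *F w₂ +F c₃ *F w₃)
    split = +-assoc (c₀ *F w₀ +F c₁ *F w₁) (c₂ *F w₂) (c₃ *F w₃)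

  ∑⁴-reorder : (f : V4 → ℕ) →
               ∑⁺ 3 f ≡ ∑[ c₂ ∈ elements ] ∑[ c₃ ∈ elements ] ∑[ c₀ ∈ elements ] ∑[ c₁ ∈ elements ] f (c₀ , c₁ , c₂ , c₃)
  ∑⁴-reorder f = begin
    ∑[ c₀ ∈ elements ] ∑[ c₁ ∈ elements ] ∑[ c₂ ∈ elements ] ∑[ c₃ ∈ elements ] f (c₀ , c₁ , c₂ , c₃)
      ≡⟨ ∑-cong elements (λ c₀ → ∑-comm elements elements _) ⟩
    ∑[ c₀ ∈ elements ] ∑[ c₂ ∈ elements ] ∑[ c₁ ∈ elements ] ∑[ c₃ ∈ elements ] f (c₀ , c₁ , c₂ , c₃)
      ≡⟨ ∑-cong elements (λ c₀ → ∑-cong elements (λ c₂ → ∑-comm elements elements _)) ⟩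
    ∑[ c₀ ∈ elements ] ∑[ c₂ ∈ elements ] ∑[ c₃ ∈ elements ] ∑[ c₁ ∈ elements ] f (c₀ , c₁ , c₂ , c₃)
      ≡⟨ ∑-comm elements elements _ ⟩
    ∑[ c₂ ∈ elements ] ∑[ c₀ ∈ elements ] ∑[ c₃ ∈ elements ] ∑[ c₁ ∈ elements ] f (c₀ , c₁ , c₂ , c₃)
      ≡⟨ ∑-cong elements (λ c₂ → ∑-comm elements elements _) ⟩
    ∑[ c₂ ∈ elements ] ∑[ c₃ ∈ elements ] ∑[ c₀ ∈ elements ] ∑[ c₁ ∈ elements ] f (c₀ , c₁ , c₂ , c₃)
      ∎
    where open ≡-Reasoning

  minor₀₁ : V4 → V4 → F
  minor₀₁ (u₀ , u₁ , _ , _) (v₀ , v₁ , _ , _) = u₀ *F v₁ -F u₁ *F v₀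

  -- Planes through the line spanned by u and v, in the chart where the minor on the first
  -- two coordinates is invertible: (c₂, c₃) is free and (c₀, c₁) is solved for.
  module Chart (u v : V4) (Δ≢0 : minor₀₁ u v ≢ 0F) where

    u₀ u₁ u₂ u₃ v₀ v₁ v₂ v₃ : F
    u₀ = proj₁ u
    u₁ = proj₁ (proj₂ u)
    u₂ = proj₁ (proj₂ (proj₂ u))
    u₃ = proj₂ (proj₂ (proj₂ u))
    v₀ = proj₁ v
    v₁ = proj₁ (proj₂ v)
    v₂ = proj₁ (proj₂ (proj₂ v))
    v₃ = proj₂ (proj₂ (proj₂ v))

    Δ⁻¹ : F
    Δ⁻¹ = inv _ Δ≢0

    X Y : F → F → F
    X c₂ c₃ = Δ⁻¹ *F (-F (c₂ *F u₂ +F c₃ *F u₃) *F v₁ -F u₁ *F -F (c₂ *F v₂ +F c₃ *F v₃))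
    Y c₂ c₃ = Δ⁻¹ *F (u₀ *F -F (c₂ *F v₂ +F c₃ *F v₃) -F -F (c₂ *F u₂ +F c₃ *F u₃) *F v₀)

    containsLine-chart : ∀ c₀ c₁ c₂ c₃ → containsLine u v (c₀ , c₁ , c₂ , c₃) ≡ (c₀ == X c₂ c₃) ∧ (c₁ == Y c₂ c₃)
    containsLine-chart c₀ c₁ c₂ c₃ = ==-∧-≡ (⇔.trans (dot≡0⇔ ×-⇔ dot≡0⇔) (cramer Δ≢0))

    ∑⁴-chart : (e : V4 → Bool) → ∑⁺ 3 (λ c → 𝟙 (containsLine u v c ∧ e c)) ≡
               ∑[ c₂ ∈ elements ] ∑[ c₃ ∈ elements ] 𝟙 (e (X c₂ c₃ , Y c₂ c₃ , c₂ , c₃))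
    ∑⁴-chart e = trans (∑⁴-reorder _) (∑-cong elements (λ c₂ → ∑-cong elements (λ c₃ → fibre c₂ c₃)))
      where
      open ≡-Reasoning
      fibre : ∀ c₂ c₃ → ∑[ c₀ ∈ elements ] ∑[ c₁ ∈ elements ] 𝟙 (containsLine u v (c₀ , c₁ , c₂ , c₃) ∧ e (c₀ , c₁ , c₂ , c₃))
                      ≡ 𝟙 (e (X c₂ c₃ , Y c₂ c₃ , c₂ , c₃))
      fibre c₂ c₃ = begin
        ∑[ c₀ ∈ elements ] ∑[ c₁ ∈ elements ] 𝟙 (containsLine u v (c₀ , c₁ , c₂ , c₃) ∧ e (c₀ , c₁ , c₂ , c₃))
          ≡⟨ ∑-cong elements (λ c₀ → ∑-cong elements (λ c₁ →
               trans (cong (λ b → 𝟙 (b ∧ e (c₀ , c₁ , c₂ , c₃))) (containsLine-chart c₀ c₁ c₂ c₃))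
                     (𝟙-∧³ (c₀ == X c₂ c₃) (c₁ == Y c₂ c₃) (e (c₀ , c₁ , c₂ , c₃))))) ⟩
        ∑[ c₀ ∈ elements ] ∑[ c₁ ∈ elements ] (𝟙 (c₀ == X c₂ c₃) * (𝟙 (c₁ == Y c₂ c₃) * 𝟙 (e (c₀ , c₁ , c₂ , c₃))))
          ≡⟨ ∑-cong elements (λ c₀ → trans (∑-*ˡ elements (𝟙 (c₀ == X c₂ c₃)) _)
                                            (cong (𝟙 (c₀ == X c₂ c₃) *_) (∑-δF (Y c₂ c₃) (λ c₁ → 𝟙 (e (c₀ , c₁ , c₂ , c₃)))))) ⟩
        ∑[ c₀ ∈ elements ] (𝟙 (c₀ == X c₂ c₃) * 𝟙 (e (c₀ , Y c₂ c₃ , c₂ , c₃)))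
          ≡⟨ ∑-δF (X c₂ c₃) (λ c₀ → 𝟙 (e (c₀ , Y c₂ c₃ , c₂ , c₃))) ⟩
        𝟙 (e (X c₂ c₃ , Y c₂ c₃ , c₂ , c₃))
          ∎

    ∑⁴-line : ∑⁺ 3 (λ c → 𝟙 (containsLine u v c)) ≡ q * q
    ∑⁴-line = begin
      ∑⁺ 3 (λ c → 𝟙 (containsLine u v c))            ≡⟨ ∑⁺-cong 3 (λ c → cong 𝟙 (sym (∧-identityʳ (containsLine u v c)))) ⟩
      ∑⁺ 3 (λ c → 𝟙 (containsLine u v c ∧ true))     ≡⟨ ∑⁴-chart (λ _ → true) ⟩
      ∑[ _ ∈ elements ] ∑[ _ ∈ elements ] 1          ≡⟨ ∑-cong elements (λ _ → ∑-1) ⟩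
      ∑[ _ ∈ elements ] q                            ≡⟨ ∑-const elements q ⟩
      q * q                                          ∎
      where open ≡-Reasoning

    ∑⁴-line-point : ∀ p → ¬ OnLine u v p → ∑⁺ 3 (λ c → 𝟙 (containsLine u v c ∧ (dot c p == 0F))) ≡ q
    ∑⁴-line-point (p₀ , p₁ , p₂ , p₃) p∉ℓ =
      trans (∑⁴-chart (λ c → dot c (p₀ , p₁ , p₂ , p₃) == 0F))
            (trans (∑-cong elements (λ c₂ → ∑-cong elements (λ c₃ → cong (λ z → 𝟙 (z == 0F)) (restriction c₂ c₃))))
                   (count-linear₂-roots ¬α≡β≡0))
      where
      -- p projects to a u + b v along the coordinates 0 and 1; α and β are the remaining discrepancies.
      a b α β : F
      a = Δ⁻¹ *F (p₀ *F v₁ -F p₁ *F v₀)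
      b = Δ⁻¹ *F (u₀ *F p₁ -F u₁ *F p₀)
      α = p₂ -F (a *F u₂ +F b *F v₂)
      β = p₃ -F (a *F u₃ +F b *F v₃)

      restriction : ∀ c₂ c₃ → dot (X c₂ c₃ , Y c₂ c₃ , c₂ , c₃) (p₀ , p₁ , p₂ , p₃) ≡ α *F c₂ +F β *F c₃
      restriction c₂ c₃ = solve 15
        (λ c₂ c₃ u₀ u₁ u₂ u₃ v₀ v₁ v₂ v₃ p₀ p₁ p₂ p₃ i →
            i :* (:- (c₂ :* u₂ :+ c₃ :* u₃) :* v₁ :- u₁ :* :- (c₂ :* v₂ :+ c₃ :* v₃)) :* p₀
         :+ i :* (u₀ :* :- (c₂ :* v₂ :+ c₃ :* v₃) :- :- (c₂ :* u₂ :+ c₃ :* u₃) :* v₀) :* p₁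
         :+ c₂ :* p₂ :+ c₃ :* p₃
         := (p₂ :- (i :* (p₀ :* v₁ :- p₁ :* v₀) :* u₂ :+ i :* (u₀ :* p₁ :- u₁ :* p₀) :* v₂)) :* c₂
         :+ (p₃ :- (i :* (p₀ :* v₁ :- p₁ :* v₀) :* u₃ :+ i :* (u₀ :* p₁ :- u₁ :* p₀) :* v₃)) :* c₃)
        refl c₂ c₃ u₀ u₁ u₂ u₃ v₀ v₁ v₂ v₃ p₀ p₁ p₂ p₃ Δ⁻¹

      projection : ∀ {p} → p *F (u₀ *F v₁ -F u₁ *F v₀) *F Δ⁻¹ ≡ p
      projection {p} = trans (*-assoc p _ Δ⁻¹) (trans (cong (p *F_) (*-inverseʳ _ Δ≢0)) (*-identityʳ p))

      ¬α≡β≡0 : ¬ (α ≡ 0F × β ≡ 0F)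
      ¬α≡β≡0 (α≡0 , β≡0) = p∉ℓ (a , b , cong₂ _,_ p₀-on (cong₂ _,_ p₁-on (cong₂ _,_ (x-y≡0⇒x≡y α≡0) (x-y≡0⇒x≡y β≡0))))
        where
        p₀-on : p₀ ≡ a *F u₀ +F b *F v₀
        p₀-on = sym (trans (solve 7 (λ u₀ u₁ v₀ v₁ p₀ p₁ i →
                              i :* (p₀ :* v₁ :- p₁ :* v₀) :* u₀ :+ i :* (u₀ :* p₁ :- u₁ :* p₀) :* v₀ := p₀ :* (u₀ :* v₁ :- u₁ :* v₀) :* i)
                              refl u₀ u₁ v₀ v₁ p₀ p₁ Δ⁻¹) projection)
        p₁-on : p₁ ≡ a *F u₁ +F b *F v₁
        p₁-on = sym (trans (solve 7 (λ u₀ u₁ v₀ v₁ p₀ p₁ i →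
                              i :* (p₀ :* v₁ :- p₁ :* v₀) :* u₁ :+ i :* (u₀ :* p₁ :- u₁ :* p₀) :* v₁ := p₁ :* (u₀ :* v₁ :- u₁ :* v₀) :* i)
                              refl u₀ u₁ v₀ v₁ p₀ p₁ Δ⁻¹) projection)

  record CoordinatePermutation : Set where
    field
      σ            : V4 → V4
      ∑⁴-σ         : ∀ f → ∑⁺ 3 (λ c → f (σ c)) ≡ ∑⁺ 3 f
      dot-σ        : ∀ c w → dot (σ c) w ≡ dot c (σ w)
      σ-involutive : ∀ w → σ (σ w) ≡ w
      σ-linear     : ∀ a b x y → σ ((a · x) ⊕ (b · y)) ≡ (a · σ x) ⊕ (b · σ y)

  open CoordinatePermutation

  ∑³-reverse : (h : F → F → F → ℕ) →
               ∑[ x ∈ elements ] ∑[ y ∈ elements ] ∑[ z ∈ elements ] h x y z ≡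
               ∑[ x ∈ elements ] ∑[ y ∈ elements ] ∑[ z ∈ elements ] h z y x
  ∑³-reverse h = begin
    ∑[ x ∈ elements ] ∑[ y ∈ elements ] ∑[ z ∈ elements ] h x y z   ≡⟨ ∑-cong elements (λ x → ∑-comm elements elements (h x)) ⟩
    ∑[ x ∈ elements ] ∑[ z ∈ elements ] ∑[ y ∈ elements ] h x y z   ≡⟨ ∑-comm elements elements _ ⟩
    ∑[ z ∈ elements ] ∑[ x ∈ elements ] ∑[ y ∈ elements ] h x y z   ≡⟨ ∑-cong elements (λ z → ∑-comm elements elements _) ⟩
    ∑[ z ∈ elements ] ∑[ y ∈ elements ] ∑[ x ∈ elements ] h x y z   ∎
    where open ≡-Reasoning

  ∑⁴-swap₂₃ : ∀ f → ∑⁺ 3 (λ (c₀ , c₁ , c₂ , c₃) → f (c₀ , c₁ , c₃ , c₂)) ≡ ∑⁺ 3 f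
  ∑⁴-swap₂₃ f = ∑-cong elements (λ c₀ → ∑-cong elements (λ c₁ → ∑-comm elements elements _))

  ∑⁴-swap₀₂ : ∀ f → ∑⁺ 3 (λ (c₀ , c₁ , c₂ , c₃) → f (c₂ , c₁ , c₀ , c₃)) ≡ ∑⁺ 3 f
  ∑⁴-swap₀₂ f = sym (∑³-reverse (λ c₀ c₁ c₂ → ∑[ c₃ ∈ elements ] f (c₀ , c₁ , c₂ , c₃)))

  identity swap₁₂ swap₁₃ swap₀₂ swap₀₃ swap₀₂₁₃ : CoordinatePermutation
  identity = record
    { σ = λ c → c ; ∑⁴-σ = λ _ → refl ; dot-σ = λ _ _ → refl ; σ-involutive = λ _ → refl ; σ-linear = λ _ _ _ _ → refl }
  swap₁₂ = record
    { σ            = λ (c₀ , c₁ , c₂ , c₃) → c₀ , c₂ , c₁ , c₃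
    ; ∑⁴-σ         = λ f → ∑-cong elements (λ c₀ → ∑-comm elements elements _)
    ; dot-σ        = λ (c₀ , c₁ , c₂ , c₃) (w₀ , w₁ , w₂ , w₃) → solve 8 (λ c₀ c₁ c₂ c₃ w₀ w₁ w₂ w₃ →
                       c₀ :* w₀ :+ c₂ :* w₁ :+ c₁ :* w₂ :+ c₃ :* w₃ := c₀ :* w₀ :+ c₁ :* w₂ :+ c₂ :* w₁ :+ c₃ :* w₃) refl c₀ c₁ c₂ c₃ w₀ w₁ w₂ w₃
    ; σ-involutive = λ _ → refl
    ; σ-linear     = λ _ _ _ _ → refl
    }
  swap₁₃ = record
    { σ            = λ (c₀ , c₁ , c₂ , c₃) → c₀ , c₃ , c₂ , c₁
    ; ∑⁴-σ         = λ f → ∑-cong elements (λ c₀ → sym (∑³-reverse (λ c₁ c₂ c₃ → f (c₀ , c₁ , c₂ , c₃))))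
    ; dot-σ        = λ (c₀ , c₁ , c₂ , c₃) (w₀ , w₁ , w₂ , w₃) → solve 8 (λ c₀ c₁ c₂ c₃ w₀ w₁ w₂ w₃ →
                       c₀ :* w₀ :+ c₃ :* w₁ :+ c₂ :* w₂ :+ c₁ :* w₃ := c₀ :* w₀ :+ c₁ :* w₃ :+ c₂ :* w₂ :+ c₃ :* w₁) refl c₀ c₁ c₂ c₃ w₀ w₁ w₂ w₃
    ; σ-involutive = λ _ → refl
    ; σ-linear     = λ _ _ _ _ → refl
    }
  swap₀₂ = record
    { σ            = λ (c₀ , c₁ , c₂ , c₃) → c₂ , c₁ , c₀ , c₃
    ; ∑⁴-σ         = ∑⁴-swap₀₂
    ; dot-σ        = λ (c₀ , c₁ , c₂ , c₃) (w₀ , w₁ , w₂ , w₃) → solve 8 (λ c₀ c₁ c₂ c₃ w₀ w₁ w₂ w₃ →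
                       c₂ :* w₀ :+ c₁ :* w₁ :+ c₀ :* w₂ :+ c₃ :* w₃ := c₀ :* w₂ :+ c₁ :* w₁ :+ c₂ :* w₀ :+ c₃ :* w₃) refl c₀ c₁ c₂ c₃ w₀ w₁ w₂ w₃
    ; σ-involutive = λ _ → refl
    ; σ-linear     = λ _ _ _ _ → refl
    }
  swap₀₃ = record
    { σ            = λ (c₀ , c₁ , c₂ , c₃) → c₃ , c₁ , c₂ , c₀
    ; ∑⁴-σ         = λ f → trans (∑⁴-swap₀₂ (λ (c₀ , c₁ , c₂ , c₃) → f (c₃ , c₁ , c₀ , c₂)))
                             (trans (∑⁴-swap₂₃ (λ (c₀ , c₁ , c₂ , c₃) → f (c₂ , c₁ , c₀ , c₃))) (∑⁴-swap₀₂ f))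
    ; dot-σ        = λ (c₀ , c₁ , c₂ , c₃) (w₀ , w₁ , w₂ , w₃) → solve 8 (λ c₀ c₁ c₂ c₃ w₀ w₁ w₂ w₃ →
                       c₃ :* w₀ :+ c₁ :* w₁ :+ c₂ :* w₂ :+ c₀ :* w₃ := c₀ :* w₃ :+ c₁ :* w₁ :+ c₂ :* w₂ :+ c₃ :* w₀) refl c₀ c₁ c₂ c₃ w₀ w₁ w₂ w₃
    ; σ-involutive = λ _ → refl
    ; σ-linear     = λ _ _ _ _ → refl
    }
  swap₀₂₁₃ = record
    { σ            = λ (c₀ , c₁ , c₂ , c₃) → c₂ , c₃ , c₀ , c₁
    ; ∑⁴-σ         = λ f → sym (∑⁴-reorder f)
    ; dot-σ        = λ (c₀ , c₁ , c₂ , c₃) (w₀ , w₁ , w₂ , w₃) → solve 8 (λ c₀ c₁ c₂ c₃ w₀ w₁ w₂ w₃ →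
                       c₂ :* w₀ :+ c₃ :* w₁ :+ c₀ :* w₂ :+ c₁ :* w₃ := c₀ :* w₂ :+ c₁ :* w₃ :+ c₂ :* w₀ :+ c₃ :* w₁) refl c₀ c₁ c₂ c₃ w₀ w₁ w₂ w₃
    ; σ-involutive = λ _ → refl
    ; σ-linear     = λ _ _ _ _ → refl
    }

  cong₄ : ∀ {a b c d a′ b′ c′ d′ : F} → a ≡ a′ → b ≡ b′ → c ≡ c′ → d ≡ d′ → (a , b , c , d) ≡ (a′ , b′ , c′ , d′)
  cong₄ refl refl refl refl = refl

  -- The coordinates of v_i · u ⊕ (- u_i) · v are, up to sign, the 2×2 minors of u and v.
  cross-diag : ∀ {x y} → y *F x +F -F x *F y ≡ 0F
  cross-diag {x} {y} = solve 2 (λ x y → y :* x :+ :- x :* y := con (ℤ.+ 0)) refl x y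

  cross-minor : ∀ {x y x′ y′} → x′ *F y -F x *F y′ ≡ 0F → y *F x′ +F -F x *F y′ ≡ 0F
  cross-minor {x} {y} {x′} {y′} m = trans (solve 4 (λ x y x′ y′ → y :* x′ :+ :- x :* y′ := x′ :* y :- x :* y′) refl x y x′ y′) m

  cross-minor⁻ : ∀ {x y x′ y′} → x *F y′ -F x′ *F y ≡ 0F → y *F x′ +F -F x *F y′ ≡ 0F
  cross-minor⁻ {x} {y} {x′} {y′} m =
    trans (solve 4 (λ x y x′ y′ → y :* x′ :+ :- x :* y′ := :- (x :* y′ :- x′ :* y)) refl x y x′ y′)
          (trans (cong -F_ m) (solve 0 (:- con (ℤ.+ 0) := con (ℤ.+ 0)) refl))

  minors-vanish⇒dependent : ∀ {u₀ u₁ u₂ u₃ v₀ v₁ v₂ v₃} → Independent (u₀ , u₁ , u₂ , u₃) (v₀ , v₁ , v₂ , v₃) →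
    u₀ *F v₁ -F u₁ *F v₀ ≡ 0F → u₀ *F v₂ -F u₂ *F v₀ ≡ 0F → u₀ *F v₃ -F u₃ *F v₀ ≡ 0F →
    u₂ *F v₁ -F u₁ *F v₂ ≡ 0F → u₃ *F v₁ -F u₁ *F v₃ ≡ 0F → u₂ *F v₃ -F u₃ *F v₂ ≡ 0F → ⊥
  minors-vanish⇒dependent {u₀} {u₁} {u₂} {u₃} {v₀} {v₁} {v₂} {v₃} indep m₀₁ m₀₂ m₀₃ m₂₁ m₃₁ m₂₃
    with v₀ ≟F 0F | v₁ ≟F 0F | v₂ ≟F 0F | v₃ ≟F 0F
  ... | no v₀≢0 | _ | _ | _ = v₀≢0 (proj₁ (indep v₀ (-F u₀) (cong₄ cross-diag (cross-minor⁻ m₀₁) (cross-minor⁻ m₀₂) (cross-minor⁻ m₀₃))))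
  ... | yes _ | no v₁≢0 | _ | _ = v₁≢0 (proj₁ (indep v₁ (-F u₁) (cong₄ (cross-minor m₀₁) cross-diag (cross-minor m₂₁) (cross-minor m₃₁))))
  ... | yes _ | yes _ | no v₂≢0 | _ = v₂≢0 (proj₁ (indep v₂ (-F u₂) (cong₄ (cross-minor m₀₂) (cross-minor⁻ m₂₁) cross-diag (cross-minor⁻ m₂₃))))
  ... | yes _ | yes _ | yes _ | no v₃≢0 = v₃≢0 (proj₁ (indep v₃ (-F u₃) (cong₄ (cross-minor m₀₃) (cross-minor⁻ m₃₁) (cross-minor m₂₃) cross-diag)))
  ... | yes v₀≡0 | yes v₁≡0 | yes v₂≡0 | yes v₃≡0 =
    0≢1 (sym (proj₂ (indep 0F 1F (cong₄ (trans (only-v v₀) v₀≡0) (trans (only-v v₁) v₁≡0) (trans (only-v v₂) v₂≡0) (trans (only-v v₃) v₃≡0)))))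
    where
    only-v : ∀ {x} y → 0F *F x +F 1F *F y ≡ y
    only-v {x} y = solve 2 (λ x y → con (ℤ.+ 0) :* x :+ con (ℤ.+ 1) :* y := y) refl x y

  independent⇒minor≢0 : ∀ {u v} → Independent u v → Σ CoordinatePermutation (λ P → minor₀₁ (σ P u) (σ P v) ≢ 0F)
  independent⇒minor≢0 {u} {v} indep with minor₀₁ u v ≟F 0F
  ... | no m≢0 = identity , m≢0
  ... | yes m₀₁ with minor₀₁ (σ swap₁₂ u) (σ swap₁₂ v) ≟F 0F
  ... | no m≢0 = swap₁₂ , m≢0
  ... | yes m₀₂ with minor₀₁ (σ swap₁₃ u) (σ swap₁₃ v) ≟F 0F
  ... | no m≢0 = swap₁₃ , m≢0
  ... | yes m₀₃ with minor₀₁ (σ swap₀₂ u) (σ swap₀₂ v) ≟F 0F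
  ... | no m≢0 = swap₀₂ , m≢0
  ... | yes m₂₁ with minor₀₁ (σ swap₀₃ u) (σ swap₀₃ v) ≟F 0F
  ... | no m≢0 = swap₀₃ , m≢0
  ... | yes m₃₁ with minor₀₁ (σ swap₀₂₁₃ u) (σ swap₀₂₁₃ v) ≟F 0F
  ... | no m≢0 = swap₀₂₁₃ , m≢0
  ... | yes m₂₃ = ⊥-elim (minors-vanish⇒dependent indep m₀₁ m₀₂ m₀₃ m₂₁ m₃₁ m₂₃)

  containsLine-σ : ∀ P u v c → containsLine u v (σ P c) ≡ containsLine (σ P u) (σ P v) c
  containsLine-σ P u v c = cong₂ (λ x y → (x == 0F) ∧ (y == 0F)) (dot-σ P c u) (dot-σ P c v)

  OnLine-σ : ∀ P {u v p} → OnLine (σ P u) (σ P v) (σ P p) → OnLine u v p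
  OnLine-σ P {u} {v} {p} (a , b , σp≡) = a , b , (begin
    p                                     ≡⟨ σ-involutive P p ⟨
    σ P (σ P p)                           ≡⟨ cong (σ P) σp≡ ⟩
    σ P ((a · σ P u) ⊕ (b · σ P v))       ≡⟨ σ-linear P a b (σ P u) (σ P v) ⟩
    (a · σ P (σ P u)) ⊕ (b · σ P (σ P v)) ≡⟨ cong₂ (λ x y → (a · x) ⊕ (b · y)) (σ-involutive P u) (σ-involutive P v) ⟩
    (a · u) ⊕ (b · v)                     ∎)
    where open ≡-Reasoning

  ∑⁴-line : ∀ {u v} → Independent u v → ∑⁺ 3 (λ c → 𝟙 (containsLine u v c)) ≡ q * q
  ∑⁴-line {u} {v} indep with independent⇒minor≢0 indep
  ... | P , Δ≢0 = begin
    ∑⁺ 3 (λ c → 𝟙 (containsLine u v c))               ≡⟨ ∑⁴-σ P _ ⟨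
    ∑⁺ 3 (λ c → 𝟙 (containsLine u v (σ P c)))         ≡⟨ ∑⁺-cong 3 (λ c → cong 𝟙 (containsLine-σ P u v c)) ⟩
    ∑⁺ 3 (λ c → 𝟙 (containsLine (σ P u) (σ P v) c))   ≡⟨ Chart.∑⁴-line (σ P u) (σ P v) Δ≢0 ⟩
    q * q                                             ∎
    where open ≡-Reasoning

  ∑⁴-line-point : ∀ {u v p} → Independent u v → ¬ OnLine u v p →
                  ∑⁺ 3 (λ c → 𝟙 (containsLine u v c ∧ (dot c p == 0F))) ≡ q
  ∑⁴-line-point {u} {v} {p} indep p∉ℓ with independent⇒minor≢0 indep
  ... | P , Δ≢0 = begin
    ∑⁺ 3 (λ c → 𝟙 (containsLine u v c ∧ (dot c p == 0F)))                         ≡⟨ ∑⁴-σ P _ ⟨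
    ∑⁺ 3 (λ c → 𝟙 (containsLine u v (σ P c) ∧ (dot (σ P c) p == 0F)))             ≡⟨ ∑⁺-cong 3 permute ⟩
    ∑⁺ 3 (λ c → 𝟙 (containsLine (σ P u) (σ P v) c ∧ (dot c (σ P p) == 0F)))       ≡⟨ Chart.∑⁴-line-point (σ P u) (σ P v) Δ≢0 (σ P p) (λ on → p∉ℓ (OnLine-σ P on)) ⟩
    q                                                                             ∎
    where
    open ≡-Reasoning
    permute : ∀ c → 𝟙 (containsLine u v (σ P c) ∧ (dot (σ P c) p == 0F)) ≡ 𝟙 (containsLine (σ P u) (σ P v) c ∧ (dot c (σ P p) == 0F))
    permute c = cong₂ (λ x y → 𝟙 (x ∧ (y == 0F))) (containsLine-σ P u v c) (dot-σ P c p)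

  ∑-allV4 : ∀ (f : V4 → ℕ) → ∑ allV4 f ≡ ∑⁺ 3 f
  ∑-allV4 f =
    trans (∑-concatMap _ elements f) (∑-cong elements (λ c₀ →
    trans (∑-concatMap _ elements f) (∑-cong elements (λ c₁ →
    trans (∑-concatMap _ elements f) (∑-cong elements (λ c₂ →
    ∑-map _ elements f))))))

  count-planes : ∀ (s : V4 → Bool) → count s planes ≡ ∑⁺ 3 (λ c → 𝟙 (normalized c ∧ s c))
  count-planes s = begin
    count s planes                                      ≡⟨ count≡∑ s planes ⟩
    ∑[ c ∈ planes ] 𝟙 (s c)                             ≡⟨ ∑-filterᵇ normalized allV4 _ ⟩
    ∑[ c ∈ allV4 ] (𝟙 (normalized c) * 𝟙 (s c))          ≡⟨ ∑-allV4 _ ⟩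
    ∑⁺ 3 (λ c → 𝟙 (normalized c) * 𝟙 (s c))             ≡⟨ ∑⁺-cong 3 (λ c → 𝟙-∧ (normalized c) (s c)) ⟨
    ∑⁺ 3 (λ c → 𝟙 (normalized c ∧ s c))                 ∎
    where open ≡-Reasoning

  dot-scale : ∀ a c w → dot (a · c) w ≡ a *F dot c w
  dot-scale a (c₀ , c₁ , c₂ , c₃) (w₀ , w₁ , w₂ , w₃) = solve 9 (λ a c₀ c₁ c₂ c₃ w₀ w₁ w₂ w₃ →
    a :* c₀ :* w₀ :+ a :* c₁ :* w₁ :+ a :* c₂ :* w₂ :+ a :* c₃ :* w₃ := a :* (c₀ :* w₀ :+ c₁ :* w₁ :+ c₂ :* w₂ :+ c₃ :* w₃))
    refl a c₀ c₁ c₂ c₃ w₀ w₁ w₂ w₃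

  incident-scale : ∀ {a} c w → a ≢ 0F → (dot (a · c) w == 0F) ≡ (dot c w == 0F)
  incident-scale {a} c w a≢0 =
    ==-≡ (λ ac·w≡0 → x*y≡0⇒y≡0 a≢0 (trans (sym (dot-scale a c w)) ac·w≡0))
         (λ c·w≡0 → trans (dot-scale a c w) (trans (cong (a *F_) c·w≡0) (zeroʳ a)))

  incident-zero : ∀ w → T (dot zeroV w == 0F)
  incident-zero (w₀ , w₁ , w₂ , w₃) = ≡⇒== (solve 4 (λ w₀ w₁ w₂ w₃ →
    con (ℤ.+ 0) :* w₀ :+ con (ℤ.+ 0) :* w₁ :+ con (ℤ.+ 0) :* w₂ :+ con (ℤ.+ 0) :* w₃ := con (ℤ.+ 0)) refl w₀ w₁ w₂ w₃)

  #units*-+1-injective : ∀ {m n} → #units * m + 1 ≡ #units * n + 1 → m ≡ n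
  #units*-+1-injective {m} {n} eq = ℕ.*-cancelˡ-≡ m n #units {{ℕ.>-nonZero 1≤#units}} (ℕ.+-cancelʳ-≡ 1 _ _ eq)

  containsLine-zero : ∀ u v → T (containsLine u v zeroV)
  containsLine-zero u v = Equivalence.from T-∧ (incident-zero u , incident-zero v)

  containsLine-scale : ∀ u v a c → a ≢ 0F → containsLine u v (a · c) ≡ containsLine u v c
  containsLine-scale u v a c a≢0 = cong₂ _∧_ (incident-scale c u a≢0) (incident-scale c v a≢0)

  module _ {u v : V4} (indep : Independent u v) where

    planes-through-line : count (containsLine u v) planes ≡ q + 1
    planes-through-line = #units*-+1-injective (begin
      #units * count (containsLine u v) planes + 1     ≡⟨ cong (λ n → #units * n + 1) (count-planes _) ⟩
      #units * ∑⁺ 3 (λ c → 𝟙 (normalized c ∧ containsLine u v c)) + 1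
        ≡⟨ projective-count 3 (containsLine u v) (containsLine-scale u v) (containsLine-zero u v) ⟩
      ∑⁺ 3 (λ c → 𝟙 (containsLine u v c))              ≡⟨ ∑⁴-line indep ⟩
      q * q                                            ≡⟨ cong (λ n → n * n) #units+1≡q ⟨
      (#units + 1) * (#units + 1)                      ≡⟨ square #units ⟩
      #units * (#units + 1 + 1) + 1                    ≡⟨ cong (λ n → #units * (n + 1) + 1) #units+1≡q ⟩
      #units * (q + 1) + 1                             ∎)
      where
      open ≡-Reasoning
      square : ∀ n → (n + 1) * (n + 1) ≡ n * (n + 1 + 1) + 1
      square = solve-∀

    planes-through-line-point : ∀ {p} → ¬ OnLine u v p → count (λ c → containsLine u v c ∧ (dot c p == 0F)) planes ≡ 1
    planes-through-line-point {p} p∉ℓ = #units*-+1-injective (begin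
      #units * count through-p planes + 1                   ≡⟨ cong (λ n → #units * n + 1) (count-planes through-p) ⟩
      #units * ∑⁺ 3 (λ c → 𝟙 (normalized c ∧ through-p c)) + 1
        ≡⟨ projective-count 3 through-p (λ a c a≢0 → cong₂ _∧_ (containsLine-scale u v a c a≢0) (incident-scale c p a≢0))
                                        (Equivalence.from T-∧ (containsLine-zero u v , incident-zero p)) ⟩
      ∑⁺ 3 (λ c → 𝟙 (through-p c))                          ≡⟨ ∑⁴-line-point indep p∉ℓ ⟩
      q                                                     ≡⟨ #units+1≡q ⟨
      #units + 1                                            ≡⟨ cong (_+ 1) (ℕ.*-identityʳ #units) ⟨
      #units * 1 + 1                                        ∎)
      where
      open ≡-Reasoning
      through-p : V4 → Bool
      through-p c = containsLine u v c ∧ (dot c p == 0F)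

  roots-peel : ∀ {d} (f : F → F) (g : F → F → F) → (∀ r t → f t -F f r ≡ (t -F r) *F g r t) →
               (∀ r → count (λ t → g r t == 0F) elements ≤ d) → count (λ t → f t == 0F) elements ≤ suc d
  roots-peel {d} f g factor bound with count≡0⊎∃ (λ t → f t == 0F) elements
  ... | inj₁ none       = ℕ.≤-trans (ℕ.≤-reflexive none) z≤n
  ... | inj₂ (r , fr≡0) = begin
    count (λ t → f t == 0F) elements                                   ≤⟨ count-mono elements root-or-factor ⟩
    count (λ t → (t == r) ∨ (g r t == 0F)) elements                    ≤⟨ count-∨ _ _ elements ⟩
    count (λ t → t == r) elements + count (λ t → g r t == 0F) elements ≡⟨ cong (_+ count (λ t → g r t == 0F) elements) (trans (count≡∑ _ elements) (count-== r)) ⟩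
    suc (count (λ t → g r t == 0F) elements)                           ≤⟨ s≤s (bound r) ⟩
    suc d                                                              ∎
    where
    open ℕ.≤-Reasoning
    root-or-factor : ∀ t → T (f t == 0F) → T ((t == r) ∨ (g r t == 0F))
    root-or-factor t ft≡0 with x*y≡0⇒x≡0⊎y≡0 (t -F r) (trans (sym (factor r t))
                                 (trans (cong₂ _-F_ (==⇒≡ ft≡0) (==⇒≡ fr≡0)) (solve 0 (con (ℤ.+ 0) :- con (ℤ.+ 0) := con (ℤ.+ 0)) refl)))
    ... | inj₁ t-r≡0  = Equivalence.from T-∨ (inj₁ (≡⇒== (x-y≡0⇒x≡y t-r≡0)))
    ... | inj₂ grt≡0 = Equivalence.from T-∨ (inj₂ (≡⇒== grt≡0))

  roots≤1 : ∀ {a} b → a ≢ 0F → count (λ t → (a *F t +F b) == 0F) elements ≤ 1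
  roots≤1 {a} b a≢0 = ℕ.≤-reflexive (trans (count≡∑ _ elements) (count-linear-root a≢0 b))

  roots≤2 : ∀ {a} b c → a ≢ 0F → count (λ t → (a *F (t *F t) +F b *F t +F c) == 0F) elements ≤ 2
  roots≤2 {a} b c a≢0 = roots-peel _ (λ r t → a *F t +F (a *F r +F b))
    (solve 5 (λ a b c r t → (a :* (t :* t) :+ b :* t :+ c) :- (a :* (r :* r) :+ b :* r :+ c) := (t :- r) :* (a :* t :+ (a :* r :+ b))) refl a b c)
    (λ r → roots≤1 (a *F r +F b) a≢0)

  roots≤3 : ∀ {a} b c d → a ≢ 0F → count (λ t → (a *F (t *F t *F t) +F b *F (t *F t) +F c *F t +F d) == 0F) elements ≤ 3
  roots≤3 {a} b c d a≢0 = roots-peel _ (λ r t → a *F (t *F t) +F (a *F r +F b) *F t +F (a *F (r *F r) +F b *F r +F c))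
    (solve 6 (λ a b c d r t → (a :* (t :* t :* t) :+ b :* (t :* t) :+ c :* t :+ d) :- (a :* (r :* r :* r) :+ b :* (r :* r) :+ c :* r :+ d)
                              := (t :- r) :* (a :* (t :* t) :+ (a :* r :+ b) :* t :+ (a :* (r :* r) :+ b :* r :+ c))) refl a b c d)
    (λ r → roots≤2 (a *F r +F b) (a *F (r *F r) +F b *F r +F c) a≢0)

  ==0-false : ∀ {x y} → x ≡ y → y ≢ 0F → (x == 0F) ≡ false
  ==0-false x≡y y≢0 = dec-false (_ ≟F 0F) (λ x≡0 → y≢0 (trans (sym x≡y) x≡0))

  count-on-𝒞-≤ : ∀ {c d} (f : F → F) → (∀ t → dot c (Pt t) ≡ f t) →
                 count (λ t → f t == 0F) elements ≤ d → count (λ t → dot c (Pt t) == 0F) elements ≤ d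
  count-on-𝒞-≤ f on-𝒞 bound = ℕ.≤-trans (ℕ.≤-reflexive (count-cong elements (λ t → cong (_== 0F) (on-𝒞 t)))) bound

  nC≤3 : ∀ c → T (normalized c) → nC c ≤ 3
  nC≤3 (c₀ , c₁ , c₂ , c₃) norm with c₀ ≟F 0F
  ... | no c₀≢0 = ℕ.+-mono-≤ (count-on-𝒞-≤ _ cubic (roots≤3 c₁ c₂ c₃ c₀≢0)) (ℕ.≤-reflexive (cong 𝟙 (==0-false at-∞ c₀≢0)))
    where
    cubic : ∀ t → dot (c₀ , c₁ , c₂ , c₃) (Pt t) ≡ c₀ *F (t *F t *F t) +F c₁ *F (t *F t) +F c₂ *F t +F c₃
    cubic t = solve 5 (λ c₀ c₁ c₂ c₃ t → c₀ :* (t :* t :* t) :+ c₁ :* (t :* t) :+ c₂ :* t :+ c₃ :* con (ℤ.+ 1)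
                                         := c₀ :* (t :* t :* t) :+ c₁ :* (t :* t) :+ c₂ :* t :+ c₃) refl c₀ c₁ c₂ c₃ t
    at-∞ : dot (c₀ , c₁ , c₂ , c₃) Pinf ≡ c₀
    at-∞ = solve 4 (λ c₀ c₁ c₂ c₃ → c₀ :* con (ℤ.+ 1) :+ c₁ :* con (ℤ.+ 0) :+ c₂ :* con (ℤ.+ 0) :+ c₃ :* con (ℤ.+ 0) := c₀)
                   refl c₀ c₁ c₂ c₃
  ... | yes refl with c₁ ≟F 0F
  ...   | no c₁≢0 = ℕ.+-mono-≤ (count-on-𝒞-≤ _ quadratic (roots≤2 c₂ c₃ c₁≢0)) (𝟙≤1 _)
    where
    quadratic : ∀ t → dot (0F , c₁ , c₂ , c₃) (Pt t) ≡ c₁ *F (t *F t) +F c₂ *F t +F c₃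
    quadratic t = solve 4 (λ c₁ c₂ c₃ t → con (ℤ.+ 0) :* (t :* t :* t) :+ c₁ :* (t :* t) :+ c₂ :* t :+ c₃ :* con (ℤ.+ 1)
                                          := c₁ :* (t :* t) :+ c₂ :* t :+ c₃) refl c₁ c₂ c₃ t
  ...   | yes refl with c₂ ≟F 0F
  ...     | no c₂≢0 = ℕ.≤-trans (ℕ.+-mono-≤ (count-on-𝒞-≤ _ linear (roots≤1 c₃ c₂≢0)) (𝟙≤1 _)) (ℕ.n≤1+n 2)
    where
    linear : ∀ t → dot (0F , 0F , c₂ , c₃) (Pt t) ≡ c₂ *F t +F c₃
    linear t = solve 3 (λ c₂ c₃ t → con (ℤ.+ 0) :* (t :* t :* t) :+ con (ℤ.+ 0) :* (t :* t) :+ c₂ :* t :+ c₃ :* con (ℤ.+ 1)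
                                    := c₂ :* t :+ c₃) refl c₂ c₃ t
  ...     | yes refl with c₃ ≟F 0F
  ...       | no c₃≢0 = ℕ.≤-trans (ℕ.+-mono-≤ (ℕ.≤-reflexive (count-none elements (λ t → ==0-false (constant t) c₃≢0))) (𝟙≤1 _))
                                  (s≤s z≤n)
    where
    constant : ∀ t → dot (0F , 0F , 0F , c₃) (Pt t) ≡ c₃
    constant t = solve 2 (λ c₃ t → con (ℤ.+ 0) :* (t :* t :* t) :+ con (ℤ.+ 0) :* (t :* t) :+ con (ℤ.+ 0) :* t :+ c₃ :* con (ℤ.+ 1)
                                   := c₃) refl c₃ t
  ...       | yes refl = ⊥-elim (0≢1 (==⇒≡ norm))

  T-not-== : ∀ {x y} → T (not (x == y)) → x ≢ y
  T-not-== {x} x≠y refl rewrite dec-true (x ≟F x) refl = x≠y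

  ==V⇒≡ : ∀ x y → T (x ==V y) → x ≡ y
  ==V⇒≡ (x₀ , x₁ , x₂ , x₃) (y₀ , y₁ , y₂ , y₃) eq
    with Equivalence.to T-∧ eq
  ... | e₀ , rest with Equivalence.to T-∧ rest
  ... | e₁ , rest′ with Equivalence.to T-∧ rest′
  ... | e₂ , e₃ = cong₄ (==⇒≡ e₀) (==⇒≡ e₁) (==⇒≡ e₂) (==⇒≡ e₃)

  proportional⇒ : ∀ c w → T (proportional c w) → ∃ λ a → a ≢ 0F × c ≡ a · w
  proportional⇒ c w prop with satisfied (any⁻ _ elements prop)
  ... | a , a-ok with Equivalence.to T-∧ a-ok
  ... | a≠0 , c==aw = a , T-not-== a≠0 , ==V⇒≡ c (a · w) c==aw

  cube≡0⇒≡0 : ∀ {x} → x *F (x *F x) ≡ 0F → x ≡ 0F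
  cube≡0⇒≡0 {x} x³≡0 with x*y≡0⇒x≡0⊎y≡0 x x³≡0
  ... | inj₁ x≡0  = x≡0
  ... | inj₂ x²≡0 with x*y≡0⇒x≡0⊎y≡0 x x²≡0
  ...   | inj₁ x≡0 = x≡0
  ...   | inj₂ x≡0 = x≡0

  nC-osc : ∀ {a} t → a ≢ 0F → nC (a · osc t) ≡ 1
  nC-osc {a} t a≢0 = cong₂ _+_
    (trans (count-cong elements (λ s → ==-≡ (only-P s) (λ { refl → at-P })))
           (trans (count≡∑ _ elements) (count-== t)))
    (cong 𝟙 (==0-false at-∞ a≢0))
    where
    triple-root : ∀ s → dot (a · osc t) (Pt s) ≡ a *F ((s -F t) *F ((s -F t) *F (s -F t)))
    triple-root s = solve 3 (λ a t s →
         a :* con (ℤ.+ 1) :* (s :* s :* s) :+ a :* (:- (con (ℤ.+ 3) :* t)) :* (s :* s)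
      :+ a :* (con (ℤ.+ 3) :* (t :* t)) :* s :+ a :* (:- (t :* t :* t)) :* con (ℤ.+ 1)
      := a :* ((s :- t) :* ((s :- t) :* (s :- t)))) refl a t s
    only-P : ∀ s → dot (a · osc t) (Pt s) ≡ 0F → s ≡ t
    only-P s on = x-y≡0⇒x≡y (cube≡0⇒≡0 (x*y≡0⇒y≡0 a≢0 (trans (sym (triple-root s)) on)))
    at-P : dot (a · osc t) (Pt t) ≡ 0F
    at-P = trans (triple-root t) (solve 2 (λ a t → a :* ((t :- t) :* ((t :- t) :* (t :- t))) := con (ℤ.+ 0)) refl a t)
    at-∞ : dot (a · osc t) Pinf ≡ a
    at-∞ = solve 2 (λ a t →
         a :* con (ℤ.+ 1) :* con (ℤ.+ 1) :+ a :* (:- (con (ℤ.+ 3) :* t)) :* con (ℤ.+ 0)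
      :+ a :* (con (ℤ.+ 3) :* (t :* t)) :* con (ℤ.+ 0) :+ a :* (:- (t :* t :* t)) :* con (ℤ.+ 0) := a) refl a t

  nC-osc∞ : ∀ {a} → a ≢ 0F → nC (a · oscInf) ≡ 1
  nC-osc∞ {a} a≢0 = cong₂ _+_
    (count-none elements (λ s → ==0-false (off-∞ s) a≢0))
    (cong 𝟙 (dec-true (_ ≟F 0F) at-∞))
    where
    off-∞ : ∀ s → dot (a · oscInf) (Pt s) ≡ a
    off-∞ s = solve 2 (λ a s →
      a :* con (ℤ.+ 0) :* (s :* s :* s) :+ a :* con (ℤ.+ 0) :* (s :* s) :+ a :* con (ℤ.+ 0) :* s :+ a :* con (ℤ.+ 1) :* con (ℤ.+ 1) := a) refl a s
    at-∞ : dot (a · oscInf) Pinf ≡ 0F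
    at-∞ = solve 1 (λ a →
      a :* con (ℤ.+ 0) :* con (ℤ.+ 1) :+ a :* con (ℤ.+ 0) :* con (ℤ.+ 0) :+ a :* con (ℤ.+ 0) :* con (ℤ.+ 0) :+ a :* con (ℤ.+ 1) :* con (ℤ.+ 0)
      := con (ℤ.+ 0)) refl a

  nC-Γ : ∀ c → T (isΓ c) → nC c ≡ 1
  nC-Γ c Γ with Equivalence.to T-∨ Γ
  ... | inj₁ finite with satisfied (any⁻ _ elements finite)
  ...   | t , c∝osc with proportional⇒ c (osc t) c∝osc
  ...     | a , a≢0 , refl = nC-osc t a≢0
  nC-Γ c Γ | inj₂ c∝osc∞ with proportional⇒ c oscInf c∝osc∞
  ...   | a , a≢0 , refl = nC-osc∞ a≢0

  𝟙-partition : ∀ n → n ≤ 3 → 𝟙 (n ==ℕ 0) + 𝟙 (n ==ℕ 1) + 𝟙 (n ==ℕ 2) + 𝟙 (n ==ℕ 3) ≡ 1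
  𝟙-partition 0 _ = refl
  𝟙-partition 1 _ = refl
  𝟙-partition 2 _ = refl
  𝟙-partition 3 _ = refl
  𝟙-partition (suc (suc (suc (suc _)))) (s≤s (s≤s (s≤s ())))

  𝟙-weights : ∀ n → n ≤ 3 → 𝟙 (n ==ℕ 1) + 2 * 𝟙 (n ==ℕ 2) + 3 * 𝟙 (n ==ℕ 3) ≡ n
  𝟙-weights 0 _ = refl
  𝟙-weights 1 _ = refl
  𝟙-weights 2 _ = refl
  𝟙-weights 3 _ = refl
  𝟙-weights (suc (suc (suc (suc _)))) (s≤s (s≤s (s≤s ())))

  Π-split-Γ : ∀ u v → Π (isDPlane 1) u v ≡ Π isΓ u v + Π isOneBar u v
  Π-split-Γ u v = begin
    Π (isDPlane 1) u v                                                              ≡⟨ count≡∑ _ planes ⟩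
    ∑[ c ∈ planes ] 𝟙 (containsLine u v c ∧ isDPlane 1 c)                          ≡⟨ ∑-cong planes split ⟩
    ∑[ c ∈ planes ] (𝟙 (containsLine u v c ∧ isΓ c) + 𝟙 (containsLine u v c ∧ isOneBar c)) ≡⟨ ∑-+ planes _ _ ⟩
    ∑[ c ∈ planes ] 𝟙 (containsLine u v c ∧ isΓ c) + ∑[ c ∈ planes ] 𝟙 (containsLine u v c ∧ isOneBar c)
                                                                                    ≡⟨ cong₂ _+_ (count≡∑ _ planes) (count≡∑ _ planes) ⟨
    Π isΓ u v + Π isOneBar u v                                                      ∎
    where
    open ≡-Reasoning
    split : ∀ c → 𝟙 (containsLine u v c ∧ isDPlane 1 c) ≡ 𝟙 (containsLine u v c ∧ isΓ c) + 𝟙 (containsLine u v c ∧ isOneBar c)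
    split c with containsLine u v c | isΓ c in Γc
    ... | false | _     = refl
    ... | true  | false = refl
    ... | true  | true  = cong (λ n → 𝟙 (n ==ℕ 1)) (nC-Γ c (subst T (sym Γc) _))

  module _ {u v : V4} (indep : Independent u v) (disjoint : NoCubicPoint u v) where

    incidences : ∑[ c ∈ planes ] (𝟙 (containsLine u v c) * nC c) ≡ q + 1
    incidences = begin
      ∑[ c ∈ planes ] (𝟙 (containsLine u v c) * nC c)
        ≡⟨ ∑-cong planes per-plane ⟩
      ∑[ c ∈ planes ] (∑[ t ∈ elements ] 𝟙 (on (Pt t) c) + 𝟙 (on Pinf c))
        ≡⟨ ∑-+ planes _ _ ⟩
      ∑[ c ∈ planes ] ∑[ t ∈ elements ] 𝟙 (on (Pt t) c) + ∑[ c ∈ planes ] 𝟙 (on Pinf c)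
        ≡⟨ cong₂ _+_ (∑-comm elements planes _) (count≡∑ (on Pinf) planes) ⟨
      ∑[ t ∈ elements ] ∑[ c ∈ planes ] 𝟙 (on (Pt t) c) + count (on Pinf) planes
        ≡⟨ cong₂ _+_ (∑-cong elements (λ t → trans (sym (count≡∑ (on (Pt t)) planes)) (planes-through-line-point indep (proj₁ disjoint t))))
                     (planes-through-line-point indep (proj₂ disjoint)) ⟩
      ∑[ _ ∈ elements ] 1 + 1
        ≡⟨ cong (_+ 1) ∑-1 ⟩
      q + 1
        ∎
      where
      open ≡-Reasoning
      on : V4 → V4 → Bool
      on p c = containsLine u v c ∧ (dot c p == 0F)
      per-plane : ∀ c → 𝟙 (containsLine u v c) * nC c ≡ ∑[ t ∈ elements ] 𝟙 (on (Pt t) c) + 𝟙 (on Pinf c)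
      per-plane c = begin
        𝟙 (containsLine u v c) * (count (λ t → dot c (Pt t) == 0F) elements + 𝟙 (dot c Pinf == 0F))
          ≡⟨ ℕ.*-distribˡ-+ (𝟙 (containsLine u v c)) _ _ ⟩
        𝟙 (containsLine u v c) * count (λ t → dot c (Pt t) == 0F) elements + 𝟙 (containsLine u v c) * 𝟙 (dot c Pinf == 0F)
          ≡⟨ cong₂ _+_ (trans (cong (𝟙 (containsLine u v c) *_) (count≡∑ _ elements))
                              (trans (sym (∑-*ˡ elements (𝟙 (containsLine u v c)) (λ t → 𝟙 (dot c (Pt t) == 0F))))
                                     (∑-cong elements (λ t → sym (𝟙-∧ (containsLine u v c) (dot c (Pt t) == 0F))))))
                       (sym (𝟙-∧ (containsLine u v c) (dot c Pinf == 0F))) ⟩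
        ∑[ t ∈ elements ] 𝟙 (on (Pt t) c) + 𝟙 (on Pinf c)
          ∎

    Π-partition : Π (isDPlane 0) u v + Π (isDPlane 1) u v + Π (isDPlane 2) u v + Π (isDPlane 3) u v ≡ q + 1
    Π-partition = begin
      Π (isDPlane 0) u v + Π (isDPlane 1) u v + Π (isDPlane 2) u v + Π (isDPlane 3) u v
        ≡⟨ trans (cong₂ _+_ (cong₂ _+_ (cong₂ _+_ (count≡∑ _ planes) (count≡∑ _ planes)) (count≡∑ _ planes)) (count≡∑ _ planes))
                 (sym (∑-+⁴ planes _ _ _ _)) ⟩
      ∑[ c ∈ planes ] (𝟙 (through c ∧ isDPlane 0 c) + 𝟙 (through c ∧ isDPlane 1 c) + 𝟙 (through c ∧ isDPlane 2 c) + 𝟙 (through c ∧ isDPlane 3 c))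
        ≡⟨ ∑-filterᵇ-cong normalized allV4 per-plane ⟩
      ∑[ c ∈ planes ] 𝟙 (through c)
        ≡⟨ count≡∑ through planes ⟨
      count through planes
        ≡⟨ planes-through-line indep ⟩
      q + 1
        ∎
      where
      open ≡-Reasoning
      through : V4 → Bool
      through = containsLine u v
      per-plane : ∀ c → T (normalized c) →
        𝟙 (through c ∧ isDPlane 0 c) + 𝟙 (through c ∧ isDPlane 1 c) + 𝟙 (through c ∧ isDPlane 2 c) + 𝟙 (through c ∧ isDPlane 3 c) ≡ 𝟙 (through c)
      per-plane c norm with through c
      ... | false = refl
      ... | true  = 𝟙-partition (nC c) (nC≤3 c norm)

    Π-weighted : Π (isDPlane 1) u v + 2 * Π (isDPlane 2) u v + 3 * Π (isDPlane 3) u v ≡ q + 1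
    Π-weighted = begin
      Π (isDPlane 1) u v + 2 * Π (isDPlane 2) u v + 3 * Π (isDPlane 3) u v
        ≡⟨ cong₂ _+_ (cong₂ _+_ (count≡∑ _ planes) (trans (cong (2 *_) (count≡∑ _ planes)) (sym (∑-*ˡ planes 2 _))))
                     (trans (cong (3 *_) (count≡∑ _ planes)) (sym (∑-*ˡ planes 3 _))) ⟩
      ∑[ c ∈ planes ] 𝟙 (through c ∧ isDPlane 1 c) + ∑[ c ∈ planes ] (2 * 𝟙 (through c ∧ isDPlane 2 c)) + ∑[ c ∈ planes ] (3 * 𝟙 (through c ∧ isDPlane 3 c))
        ≡⟨ ∑-+³ planes _ _ _ ⟨
      ∑[ c ∈ planes ] (𝟙 (through c ∧ isDPlane 1 c) + 2 * 𝟙 (through c ∧ isDPlane 2 c) + 3 * 𝟙 (through c ∧ isDPlane 3 c))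
        ≡⟨ ∑-filterᵇ-cong normalized allV4 per-plane ⟩
      ∑[ c ∈ planes ] (𝟙 (through c) * nC c)
        ≡⟨ incidences ⟩
      q + 1
        ∎
      where
      open ≡-Reasoning
      through : V4 → Bool
      through = containsLine u v
      per-plane : ∀ c → T (normalized c) →
        𝟙 (through c ∧ isDPlane 1 c) + 2 * 𝟙 (through c ∧ isDPlane 2 c) + 3 * 𝟙 (through c ∧ isDPlane 3 c) ≡ 𝟙 (through c) * nC c
      per-plane c norm with through c
      ... | false = refl
      ... | true  = trans (𝟙-weights (nC c) (nC≤3 c norm)) (sym (ℕ.+-identityʳ (nC c)))

theorem4p4 : (K : FiniteField) → let open FiniteField K in
    5 ≤ q → (u v : V4) → Independent u v → NoCubicPoint u v →
      (Π isΓ u v + Π isOneBar u v + 2 * Π (isDPlane 2) u v + 3 * Π (isDPlane 3) u v ≡ q + 1)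
      × (Π (isDPlane 0) u v ≡ Π (isDPlane 2) u v + 2 * Π (isDPlane 3) u v)
theorem4p4 K _ u v indep disjoint =
  trans (cong (λ n → n + 2 * Π (isDPlane 2) u v + 3 * Π (isDPlane 3) u v) (sym (Π-split-Γ K u v))) (Π-weighted K indep disjoint) ,
  count-difference (Π-partition K indep disjoint) (Π-weighted K indep disjoint)
  where open FiniteField K
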